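{- Let $G$ be a finite simple undirected graph with a cut-edge $e$. Then $\eta_{\mathcal{H}}(G)=\eta_{\mathcal{H}}(G/e)$.
   Context: A cut-edge is an edge whose removal increases the number of connected components. For an edge $e=uv$ with $N_G(u)\cap N_G(v)=\emptyset$ (as holds for a cut-edge), the contraction $G/e$ is the simple graph obtained by replacing $u$ and $v$ by a single new vertex whose incident edges are the edges other than $e$ incident to $u$ or $v$. For a graph $G$ with arbitrary orientations on edges (tail $e^-$, head $e^+$) and on triangles (cyclic order $(i,j,k)$; an edge $e$ of $\vartriangle$ lies in $\vartriangle^+$ if $(e^-,e^+)\in\{(i,j),(j,k),(k,i)\}$, in $\vartriangle^-$ otherwise), $\mathcal{B}(G)$ is the edge-vertex matrix with $(e,v)$-entry $-1$ if $v=e^-$, $1$ if $v=e^+$, $0$ otherwise, and $\mathcal{C}(G)$ is the triangle-edge matrix with $(\vartriangle,e)$-entry $1$ if $e\in\vartriangle^+$, $-1$ if $e\in\vartriangle^-$, $0$ otherwise. $\mathcal{H}(G)=\mathcal{B}(G)\mathcal{B}(G)^{\top}+\mathcal{C}(G)^{\top}\mathcal{C}(G)$ and $\eta_{\mathcal{H}}(G)$ is its nullity (multiplicity of eigenvalue $0$); it does not depend on the chosen orientations. -}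

module Defs where

open import Data.Nat using (ℕ; zero; suc; _<_; _<ᵇ_)
open import Data.Fin using (Fin; zero; suc; toℕ; punchOut; _≟_)
open import Data.Fin.Properties using ()
open import Data.Bool using (Bool; true; false; _∧_; _∨_; not; if_then_else_)
open import Data.Bool.Properties using (∨-comm; ∧-comm)
open import Data.List using (List; []; _∷_; [_]; concat; map; length; lookup; allFin)
open import Data.Product using (Σ; _×_; _,_; proj₁; proj₂)
open import Data.Rational using (ℚ; 0ℚ; 1ℚ; _+_; _*_; -_)
open import Data.Empty using (⊥-elim)
open import Relation.Nullary using (¬_; yes; no)
open import Relation.Nullary.Decidable using (isYes)
open import Relation.Binary.PropositionalEquality using (_≡_; _≢_; refl; sym; cong)

record Graph (n : ℕ) : Set where
  field
    adj    : Fin n → Fin n → Bool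
    adj-sym    : ∀ i j → adj i j ≡ adj j i
    adj-irrefl : ∀ i → adj i i ≡ false
open Graph public

_==_ : ∀ {n} → Fin n → Fin n → Bool
a == b = isYes (a ≟ b)

anyFin : ∀ {n} → (Fin n → Bool) → Bool
anyFin {zero}  f = false
anyFin {suc n} f = f zero ∨ anyFin (λ i → f (suc i))

countFin : ∀ {n} → (Fin n → Bool) → ℕ
countFin {zero}  f = zero
countFin {suc n} f = (if f zero then 1 else 0) Data.Nat.+ countFin (λ i → f (suc i))

sumFin : ∀ {n} → (Fin n → ℚ) → ℚ
sumFin {zero}  f = 0ℚ
sumFin {suc n} f = f zero + sumFin (λ i → f (suc i))

reachWithin : ∀ {n} → Graph n → ℕ → Fin n → Fin n → Bool
reachWithin G zero    i j = i == j
reachWithin G (suc k) i j =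
  reachWithin G k i j ∨ anyFin (λ l → reachWithin G k i l ∧ adj G l j)

-- i and j are in the same connected component (walks of length ≤ n suffice)
connected : ∀ {n} → Graph n → Fin n → Fin n → Bool
connected {n} G = reachWithin G n

-- number of connected components = number of vertices that are the
-- least vertex (in the order of Fin n) of their component
components : ∀ {n} → Graph n → ℕ
components G =
  countFin (λ i → not (anyFin (λ j → (toℕ j <ᵇ toℕ i) ∧ connected G j i)))

isUV : ∀ {n} → Fin n → Fin n → Fin n → Fin n → Bool
isUV u v a b = (a == u ∧ b == v) ∨ (a == v ∧ b == u)

isUV-sym : ∀ {n} (u v a b : Fin n) → isUV u v a b ≡ isUV u v b a
isUV-sym u v a b
  rewrite ∧-comm (a == u) (b == v) | ∧-comm (a == v) (b == u)
  = ∨-comm (b == v ∧ a == u) (b == u ∧ a == v)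

deleteEdge : ∀ {n} → Graph n → Fin n → Fin n → Graph n
deleteEdge G u v = record
  { adj = λ a b → adj G a b ∧ not (isUV u v a b)
  ; adj-sym = λ a b → Relation.Binary.PropositionalEquality.cong₂ (λ x y → x ∧ not y)
                         (adj-sym G a b) (isUV-sym u v a b)
  ; adj-irrefl = λ a → Relation.Binary.PropositionalEquality.cong (λ x → x ∧ not (isUV u v a a)) (adj-irrefl G a)
  }

IsCutEdge : ∀ {n} → Graph n → Fin n → Fin n → Set
IsCutEdge G u v = (adj G u v ≡ true) × (components G < components (deleteEdge G u v))

-- Contraction G/e of the edge e = uv (u ≠ v): v is identified with u.
-- Vertex set Fin (suc n) → Fin n via collapse.

collapse : ∀ {n} (u v : Fin (suc n)) → v ≢ u → Fin (suc n) → Fin n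
collapse u v v≢u x with x ≟ v
... | yes _   = punchOut v≢u
... | no  x≢v = punchOut (λ v≡x → x≢v (sym v≡x))

contrRel : ∀ {n} → Graph (suc n) → (u v : Fin (suc n)) → v ≢ u → Fin n → Fin n → Bool
contrRel G u v v≢u a b =
  anyFin (λ x → anyFin (λ y →
    (collapse u v v≢u x == a) ∧ (collapse u v v≢u y == b) ∧ adj G x y))

contrAdj : ∀ {n} → Graph (suc n) → (u v : Fin (suc n)) → v ≢ u → Fin n → Fin n → Bool
contrAdj G u v v≢u a b with a ≟ b
... | yes _ = false
... | no  _ = contrRel G u v v≢u a b ∨ contrRel G u v v≢u b a

contrAdj-irrefl : ∀ {n} (G : Graph (suc n)) u v (v≢u : v ≢ u) a → contrAdj G u v v≢u a a ≡ false
contrAdj-irrefl G u v v≢u a with a ≟ a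
... | yes _ = refl
... | no ¬p = ⊥-elim (¬p refl)

contrAdj-sym : ∀ {n} (G : Graph (suc n)) u v (v≢u : v ≢ u) a b →
               contrAdj G u v v≢u a b ≡ contrAdj G u v v≢u b a
contrAdj-sym G u v v≢u a b with a ≟ b | b ≟ a
... | yes _ | yes _ = refl
... | yes p | no ¬q = ⊥-elim (¬q (sym p))
... | no ¬p | yes q = ⊥-elim (¬p (sym q))
... | no _  | no _  = ∨-comm (contrRel G u v v≢u a b) (contrRel G u v v≢u b a)

contract : ∀ {n} → Graph (suc n) → (u v : Fin (suc n)) → v ≢ u → Graph n
contract G u v v≢u = record
  { adj = contrAdj G u v v≢u
  ; adj-sym = contrAdj-sym G u v v≢u
  ; adj-irrefl = contrAdj-irrefl G u v v≢u
  }

-- Edges and triangles with fixed orientations.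
-- Edge {i,j} with i < j is oriented i → j (tail i, head j).
-- Triangle {i,j,k} with i < j < k has cyclic order (i,j,k).

_<F_ : ∀ {n} → Fin n → Fin n → Bool
i <F j = toℕ i <ᵇ toℕ j

edges : ∀ {n} → Graph n → List (Fin n × Fin n)
edges {n} G = concat (map (λ i → concat (map (λ j →
  if (i <F j) ∧ adj G i j then [ (i , j) ] else []) (allFin n))) (allFin n))

Triple : ℕ → Set
Triple n = Fin n × Fin n × Fin n

triangles : ∀ {n} → Graph n → List (Triple n)
triangles {n} G = concat (map (λ i → concat (map (λ j → concat (map (λ k →
  if (i <F j) ∧ (j <F k) ∧ adj G i j ∧ adj G j k ∧ adj G i k
  then [ (i , j , k) ] else []) (allFin n))) (allFin n))) (allFin n))

nE : ∀ {n} → Graph n → ℕ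
nE G = length (edges G)

nT : ∀ {n} → Graph n → ℕ
nT G = length (triangles G)

edgeAt : ∀ {n} (G : Graph n) → Fin (nE G) → Fin n × Fin n
edgeAt G = lookup (edges G)

triAt : ∀ {n} (G : Graph n) → Fin (nT G) → Triple n
triAt G = lookup (triangles G)

𝓑 : ∀ {n} (G : Graph n) → Fin (nE G) → Fin n → ℚ
𝓑 G e w with edgeAt G e
... | (t , h) = if w == t then - 1ℚ else (if w == h then 1ℚ else 0ℚ)

pairEq : ∀ {n} → Fin n × Fin n → Fin n → Fin n → Bool
pairEq (a , b) x y = (a == x) ∧ (b == y)

inPlus : ∀ {n} → Triple n → Fin n × Fin n → Bool
inPlus (i , j , k) p = pairEq p i j ∨ pairEq p j k ∨ pairEq p k i

𝓒 : ∀ {n} (G : Graph n) → Fin (nT G) → Fin (nE G) → ℚ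
𝓒 G T e with edgeAt G e
... | (t , h) =
  if inPlus (triAt G T) (t , h) then 1ℚ
  else (if inPlus (triAt G T) (h , t) then - 1ℚ else 0ℚ)

𝓗 : ∀ {n} (G : Graph n) → Fin (nE G) → Fin (nE G) → ℚ
𝓗 G e f = sumFin (λ w → 𝓑 G e w * 𝓑 G f w) + sumFin (λ T → 𝓒 G T e * 𝓒 G T f)

InKer : ∀ {m} → (Fin m → Fin m → ℚ) → (Fin m → ℚ) → Set
InKer M x = ∀ i → sumFin (λ j → M i j * x j) ≡ 0ℚ

LinIndep : ∀ {m k} → (Fin k → Fin m → ℚ) → Set
LinIndep {m} {k} vs = ∀ (c : Fin k → ℚ) →
  (∀ j → sumFin (λ i → c i * vs i j) ≡ 0ℚ) → ∀ i → c i ≡ 0ℚ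

HasNullity : ∀ {m} → (Fin m → Fin m → ℚ) → ℕ → Set
HasNullity {m} M k =
  (Σ (Fin k → Fin m → ℚ) λ vs → (∀ i → InKer M (vs i)) × LinIndep vs)
  × (∀ (ws : Fin (suc k) → Fin m → ℚ) → (∀ i → InKer M (ws i)) → ¬ LinIndep ws)

-- The kernel of 𝓗 = 𝓑𝓑ᵀ + 𝓒ᵀ𝓒 is the common kernel of 𝓑ᵀ and 𝓒, since xᵀ𝓗x = |𝓑ᵀx|² + |𝓒x|².
-- Reading an edge vector as an antisymmetric flow on ordered vertex pairs, 𝓑ᵀx is minus its
-- divergence and 𝓒x its circulation around each triangle, so the kernel consists of the harmonic
-- flows: divergence-free and circulation-free.  A harmonic flow vanishes on a cut edge uv, because
-- the divergence summed over the side of u is exactly the flow through uv.  Hence pushing flows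
-- forward along the contraction G → G/uv and pulling them back along the edges of G ∖ uv are
-- mutually inverse linear maps between harmonic flows.  Triangles correspond since u and v have no
-- common neighbour and a closed walk through the merged vertex cannot switch sides; divergence at
-- the merged vertex splits into the two sides, each carrying zero flux.  Isomorphic kernels have
-- equal nullity.

module Submission where

open import Defs
open import Algebra.Bundles using (CommutativeRing)
open import Data.Bool using (Bool; true; false; _∧_; _∨_; not; if_then_else_; T)
import Data.Bool.Properties as Bool
open import Data.Empty using (⊥; ⊥-elim)
open import Data.Fin using (Fin; zero; suc; toℕ; punchIn; punchOut; _≟_)
import Data.Fin.Properties as Fin
open import Data.Nat using (ℕ; zero; suc)
import Data.Nat as ℕ
import Data.Nat.Properties as ℕ
open import Data.Product using (∃; _×_; _,_; proj₁; proj₂)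
open import Data.Rational using (ℚ; 0ℚ; 1ℚ; _+_; _*_; -_; _≤_; _<_)
import Data.Rational as ℚ
import Data.Rational.Properties as ℚ
open import Data.Rational.Solver using (module +-*-Solver)
open import Data.Sum using (_⊎_; inj₁; inj₂)
open import Data.Unit using (tt)
open import Data.List using (List; []; _∷_; [_]; _++_; concat; map; lookup; allFin; tabulate)
import Data.List.Properties as List
open import Data.Vec.Functional using (removeAt)
open import Function using (_∘_; id)
open import Function.Bundles using (_⇔_; mk⇔; Equivalence)
open import Relation.Binary using (tri<; tri≈; tri>)
open import Relation.Binary.PropositionalEquality hiding ([_])
open import Relation.Nullary using (yes; no; contradiction)
open import Relation.Nullary.Decidable using (isYes≗does; dec-true; dec-false; toWitness; toSum)

open +-*-Solver
open import Algebra.Properties.Group ℚ.+-0-group using (identityʳ-unique)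
open import Algebra.Properties.Semiring.Sum (CommutativeRing.semiring ℚ.+-*-commutativeRing)
  using (sum; sum-remove; sum-cong-≗; ∑-distrib-+; ∑-comm; *-distribˡ-sum; *-distribʳ-sum)

==-refl : ∀ {n} (a : Fin n) → (a == a) ≡ true
==-refl a = trans (isYes≗does (a ≟ a)) (dec-true (a ≟ a) refl)

≢⇒==-false : ∀ {n} {a b : Fin n} → a ≢ b → (a == b) ≡ false
≢⇒==-false {a = a} {b} a≢b = trans (isYes≗does (a ≟ b)) (dec-false (a ≟ b) a≢b)

==⇒≡ : ∀ {n} {a b : Fin n} → (a == b) ≡ true → a ≡ b
==⇒≡ {a = a} {b} h = toWitness (subst T (sym h) tt)

==-sym : ∀ {n} (a b : Fin n) → (a == b) ≡ (b == a)
==-sym a b with a ≟ b | b ≟ a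
... | yes _   | yes _   = refl
... | no  _   | no  _   = refl
... | yes a≡b | no  b≢a = contradiction (sym a≡b) b≢a
... | no  a≢b | yes b≡a = contradiction (sym b≡a) a≢b

true≢false : true ≢ false
true≢false ()

∧-true⁻ : ∀ {a b} → (a ∧ b) ≡ true → a ≡ true × b ≡ true
∧-true⁻ {true} {true} _ = refl , refl

∧-true⁺ : ∀ {a b} → a ≡ true → b ≡ true → (a ∧ b) ≡ true
∧-true⁺ refl refl = refl

∧-falseˡ : ∀ {a} b → a ≡ false → (a ∧ b) ≡ false
∧-falseˡ b refl = refl

∧-falseʳ : ∀ a {b} → b ≡ false → (a ∧ b) ≡ false
∧-falseʳ a refl = Bool.∧-zeroʳ a

∨-true⁻ : ∀ {a b} → (a ∨ b) ≡ true → a ≡ true ⊎ b ≡ true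
∨-true⁻ {true}  _ = inj₁ refl
∨-true⁻ {false} h = inj₂ h

∨-trueˡ : ∀ {a} b → a ≡ true → (a ∨ b) ≡ true
∨-trueˡ b refl = refl

∨-trueʳ : ∀ a {b} → b ≡ true → (a ∨ b) ≡ true
∨-trueʳ a refl = Bool.∨-zeroʳ a

not-true⁻ : ∀ {b} → not b ≡ true → b ≡ false
not-true⁻ {false} _ = refl

pairEq-false : ∀ {N} (i j a b : Fin N) → (i ≡ a → j ≡ b → ⊥) → pairEq (i , j) a b ≡ false
pairEq-false i j a b ≢ab with i ≟ a | j ≟ b
... | yes i≡a | yes j≡b = ⊥-elim (≢ab i≡a j≡b)
... | yes _   | no  _   = refl
... | no  _   | _       = refl

pairEq⇒≡ : ∀ {N} (i j a b : Fin N) → pairEq (i , j) a b ≡ true → i ≡ a × j ≡ b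
pairEq⇒≡ i j a b ij≡ab = ==⇒≡ (proj₁ (∧-true⁻ {i == a} ij≡ab)) , ==⇒≡ (proj₂ (∧-true⁻ {i == a} ij≡ab))

-- Finite sums

when : Bool → ℚ → ℚ
when b x = if b then x else 0ℚ

indicator : Bool → ℚ
indicator b = when b 1ℚ

when-zero : ∀ b → when b 0ℚ ≡ 0ℚ
when-zero true  = refl
when-zero false = refl

when-∧ : ∀ a b x → when (a ∧ b) x ≡ when a (when b x)
when-∧ true  b x = refl
when-∧ false b x = refl

when-comm : ∀ a b x → when a (when b x) ≡ when b (when a x)
when-comm true  true  x = refl
when-comm true  false x = refl
when-comm false true  x = refl
when-comm false false x = refl

when-*ˡ : ∀ b c x → when b (c * x) ≡ c * when b x
when-*ˡ true  c x = refl
when-*ˡ false c x = sym (ℚ.*-zeroʳ c)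

when-neg : ∀ b x → when b (- x) ≡ - when b x
when-neg true  x = refl
when-neg false x = refl

indicator-* : ∀ b x → indicator b * x ≡ when b x
indicator-* true  x = ℚ.*-identityˡ x
indicator-* false x = ℚ.*-zeroˡ x

when-true : ∀ {b} x → b ≡ true → when b x ≡ x
when-true x refl = refl

when-false : ∀ {b} x → b ≡ false → when b x ≡ 0ℚ
when-false x refl = refl

when-irrelevant : ∀ a b {x} → x ≡ 0ℚ → when a x ≡ when b x
when-irrelevant a b refl = trans (when-zero a) (sym (when-zero b))

when-complement : ∀ b x → when b x ≡ x + - when (not b) x
when-complement true  x = sym (ℚ.+-identityʳ x)
when-complement false x = sym (ℚ.+-inverseʳ x)

when-∧-indicator : ∀ a b x → when a (when b x) ≡ indicator (a ∧ b) * x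
when-∧-indicator true  true  x = sym (ℚ.*-identityˡ x)
when-∧-indicator true  false x = sym (ℚ.*-zeroˡ x)
when-∧-indicator false b     x = sym (ℚ.*-zeroˡ x)

sumFin≡sum : ∀ {n} (f : Fin n → ℚ) → sumFin f ≡ sum f
sumFin≡sum {zero}  f = refl
sumFin≡sum {suc n} f = cong (f zero +_) (sumFin≡sum (f ∘ suc))

sumFin-cong : ∀ {n} {f g : Fin n → ℚ} → (∀ i → f i ≡ g i) → sumFin f ≡ sumFin g
sumFin-cong {zero}  f≗g = refl
sumFin-cong {suc n} f≗g = cong₂ _+_ (f≗g zero) (sumFin-cong (f≗g ∘ suc))

sumFin-zero : ∀ {n} {f : Fin n → ℚ} → (∀ i → f i ≡ 0ℚ) → sumFin f ≡ 0ℚ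
sumFin-zero {zero}  f≗0 = refl
sumFin-zero {suc n} f≗0 = cong₂ _+_ (f≗0 zero) (sumFin-zero (f≗0 ∘ suc))

sumFin-+ : ∀ {n} (f g : Fin n → ℚ) → sumFin (λ i → f i + g i) ≡ sumFin f + sumFin g
sumFin-+ f g = begin
  sumFin (λ i → f i + g i) ≡⟨ sumFin≡sum (λ i → f i + g i) ⟩
  sum (λ i → f i + g i)    ≡⟨ ∑-distrib-+ f g ⟩
  sum f + sum g            ≡⟨ cong₂ _+_ (sumFin≡sum f) (sumFin≡sum g) ⟨
  sumFin f + sumFin g      ∎
  where open ≡-Reasoning

sumFin-neg : ∀ {n} (f : Fin n → ℚ) → sumFin (λ i → - f i) ≡ - sumFin f
sumFin-neg {zero}  f = refl
sumFin-neg {suc n} f = trans (cong (- f zero +_) (sumFin-neg (f ∘ suc))) (sym (ℚ.neg-distrib-+ (f zero) _))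

*-distribˡ-sumFin : ∀ {n} c (f : Fin n → ℚ) → c * sumFin f ≡ sumFin (λ i → c * f i)
*-distribˡ-sumFin c f = begin
  c * sumFin f             ≡⟨ cong (c *_) (sumFin≡sum f) ⟩
  c * sum f                ≡⟨ *-distribˡ-sum c f ⟩
  sum (λ i → c * f i)      ≡⟨ sumFin≡sum (λ i → c * f i) ⟨
  sumFin (λ i → c * f i)   ∎
  where open ≡-Reasoning

*-distribʳ-sumFin : ∀ {n} c (f : Fin n → ℚ) → sumFin f * c ≡ sumFin (λ i → f i * c)
*-distribʳ-sumFin c f = begin
  sumFin f * c             ≡⟨ cong (_* c) (sumFin≡sum f) ⟩
  sum f * c                ≡⟨ *-distribʳ-sum c f ⟩
  sum (λ i → f i * c)      ≡⟨ sumFin≡sum (λ i → f i * c) ⟨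
  sumFin (λ i → f i * c)   ∎
  where open ≡-Reasoning

when-distrib-sumFin : ∀ {n} b (f : Fin n → ℚ) → when b (sumFin f) ≡ sumFin (λ i → when b (f i))
when-distrib-sumFin true  f = refl
when-distrib-sumFin false f = sym (sumFin-zero {f = λ i → when false (f i)} (λ _ → refl))

sumFin-comm : ∀ {m n} (f : Fin m → Fin n → ℚ) →
              sumFin (λ i → sumFin (f i)) ≡ sumFin (λ j → sumFin (λ i → f i j))
sumFin-comm f = begin
  sumFin (λ i → sumFin (f i))            ≡⟨ sumFin≡sum (λ i → sumFin (f i)) ⟩
  sum (λ i → sumFin (f i))               ≡⟨ sum-cong-≗ (λ i → sumFin≡sum (f i)) ⟩
  sum (λ i → sum (f i))                  ≡⟨ ∑-comm f ⟩
  sum (λ j → sum (λ i → f i j))          ≡⟨ sum-cong-≗ (λ j → sumFin≡sum (λ i → f i j)) ⟨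
  sum (λ j → sumFin (λ i → f i j))       ≡⟨ sumFin≡sum (λ j → sumFin (λ i → f i j)) ⟨
  sumFin (λ j → sumFin (λ i → f i j))    ∎
  where open ≡-Reasoning

sumFin-remove : ∀ {n} (k : Fin (suc n)) (f : Fin (suc n) → ℚ) →
                sumFin f ≡ f k + sumFin (removeAt f k)
sumFin-remove k f = begin
  sumFin f                    ≡⟨ sumFin≡sum f ⟩
  sum f                       ≡⟨ sum-remove f ⟩
  f k + sum (removeAt f k)    ≡⟨ cong (f k +_) (sumFin≡sum (removeAt f k)) ⟨
  f k + sumFin (removeAt f k) ∎
  where open ≡-Reasoning

sumFin-single : ∀ {n} (k : Fin n) (f : Fin n → ℚ) → (∀ i → i ≢ k → f i ≡ 0ℚ) → sumFin f ≡ f k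
sumFin-single {suc n} k f others≡0 = begin
  sumFin f                    ≡⟨ sumFin-remove k f ⟩
  f k + sumFin (removeAt f k) ≡⟨ cong (f k +_) (sumFin-zero (λ j → others≡0 _ (Fin.punchInᵢ≢i k j))) ⟩
  f k + 0ℚ                    ≡⟨ ℚ.+-identityʳ (f k) ⟩
  f k                         ∎
  where open ≡-Reasoning

sumFin-single₂ : ∀ {m n} (a : Fin m) (b : Fin n) (f : Fin m → Fin n → ℚ) →
                 (∀ i j → (i ≡ a → j ≡ b → ⊥) → f i j ≡ 0ℚ) →
                 sumFin (λ i → sumFin (f i)) ≡ f a b
sumFin-single₂ a b f others≡0 =
  trans (sumFin-single a _ (λ i i≢a → sumFin-zero (λ j → others≡0 i j (λ i≡a _ → i≢a i≡a))))
        (sumFin-single b _ (λ j j≢b → others≡0 a j (λ _ j≡b → j≢b j≡b)))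

sumFin-delta : ∀ {n} (k : Fin n) (f : Fin n → ℚ) → sumFin (λ i → when (i == k) (f i)) ≡ f k
sumFin-delta k f = trans (sumFin-single k _ off-k) (when-true (f k) (==-refl k))
  where
  off-k : ∀ i → i ≢ k → when (i == k) (f i) ≡ 0ℚ
  off-k i i≢k = when-false (f i) (≢⇒==-false i≢k)

sumFin-delta₂ : ∀ {m n} (a : Fin m) (b : Fin n) (h : Fin m → Fin n → ℚ) →
                sumFin (λ i → sumFin (λ j → when ((i == a) ∧ (j == b)) (h i j))) ≡ h a b
sumFin-delta₂ a b h = begin
  sumFin (λ i → sumFin (λ j → when ((i == a) ∧ (j == b)) (h i j)))
    ≡⟨ sumFin-cong (λ i → sumFin-cong (λ j → when-∧ (i == a) (j == b) (h i j))) ⟩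
  sumFin (λ i → sumFin (λ j → when (i == a) (when (j == b) (h i j))))
    ≡⟨ sumFin-cong (λ i → when-distrib-sumFin (i == a) (λ j → when (j == b) (h i j))) ⟨
  sumFin (λ i → when (i == a) (sumFin (λ j → when (j == b) (h i j))))
    ≡⟨ sumFin-delta a (λ i → sumFin (λ j → when (j == b) (h i j))) ⟩
  sumFin (λ j → when (j == b) (h a j))
    ≡⟨ sumFin-delta b (h a) ⟩
  h a b ∎
  where open ≡-Reasoning

sumFin-delta₃ : ∀ {m n p} (a : Fin m) (b : Fin n) (c : Fin p) (h : Fin m → Fin n → Fin p → ℚ) →
                sumFin (λ i → sumFin (λ j → sumFin (λ k → when ((i == a) ∧ (j == b) ∧ (k == c)) (h i j k)))) ≡ h a b c
sumFin-delta₃ a b c h = begin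
  sumFin (λ i → sumFin (λ j → sumFin (λ k → when ((i == a) ∧ (j == b) ∧ (k == c)) (h i j k))))
    ≡⟨ sumFin-cong (λ i → sumFin-cong (λ j → sumFin-cong (λ k → reassoc (i == a) (j == b) (k == c) (h i j k)))) ⟩
  sumFin (λ i → sumFin (λ j → sumFin (λ k → when ((i == a) ∧ (j == b)) (when (k == c) (h i j k)))))
    ≡⟨ sumFin-cong (λ i → sumFin-cong (λ j → when-distrib-sumFin ((i == a) ∧ (j == b)) (λ k → when (k == c) (h i j k)))) ⟨
  sumFin (λ i → sumFin (λ j → when ((i == a) ∧ (j == b)) (sumFin (λ k → when (k == c) (h i j k)))))
    ≡⟨ sumFin-delta₂ a b (λ i j → sumFin (λ k → when (k == c) (h i j k))) ⟩
  sumFin (λ k → when (k == c) (h a b k))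
    ≡⟨ sumFin-delta c (h a b) ⟩
  h a b c ∎
  where
  open ≡-Reasoning
  reassoc : ∀ x y z q → when (x ∧ y ∧ z) q ≡ when (x ∧ y) (when z q)
  reassoc x y z q = trans (cong (λ b → when b q) (sym (Bool.∧-assoc x y z))) (when-∧ (x ∧ y) z q)

sumFin-sub : ∀ {n} (f g : Fin n → ℚ) → sumFin (λ i → f i + - g i) ≡ sumFin f + - sumFin g
sumFin-sub f g = trans (sumFin-+ f (λ i → - g i)) (cong (sumFin f +_) (sumFin-neg g))

sumFin₂ : ∀ {m n} → (Fin m → Fin n → ℚ) → ℚ
sumFin₂ h = sumFin (λ i → sumFin (h i))

sumFin₂-+ : ∀ {m n} (f g : Fin m → Fin n → ℚ) → sumFin₂ (λ i j → f i j + g i j) ≡ sumFin₂ f + sumFin₂ g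
sumFin₂-+ f g = trans (sumFin-cong (λ i → sumFin-+ (f i) (g i))) (sumFin-+ (sumFin ∘ f) (sumFin ∘ g))

sumFin₂-neg : ∀ {m n} (f : Fin m → Fin n → ℚ) → sumFin₂ (λ i j → - f i j) ≡ - sumFin₂ f
sumFin₂-neg f = trans (sumFin-cong (λ i → sumFin-neg (f i))) (sumFin-neg (sumFin ∘ f))

sumFin₂-sub : ∀ {m n} (f g : Fin m → Fin n → ℚ) → sumFin₂ (λ i j → f i j + - g i j) ≡ sumFin₂ f + - sumFin₂ g
sumFin₂-sub f g = trans (sumFin-cong (λ i → sumFin-sub (f i) (g i))) (sumFin-sub (sumFin ∘ f) (sumFin ∘ g))

+-nonneg-zeroˡ : ∀ {a b} → 0ℚ ≤ a → 0ℚ ≤ b → a + b ≡ 0ℚ → a ≡ 0ℚ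
+-nonneg-zeroˡ {a} {b} 0≤a 0≤b a+b≡0 = ℚ.≤-antisym a≤0 0≤a
  where
  open ℚ.≤-Reasoning
  a≤0 : a ≤ 0ℚ
  a≤0 = begin
    a      ≡⟨ ℚ.+-identityʳ a ⟨
    a + 0ℚ ≤⟨ ℚ.+-monoʳ-≤ a 0≤b ⟩
    a + b  ≡⟨ a+b≡0 ⟩
    0ℚ     ∎

+-nonneg-zeroʳ : ∀ {a b} → 0ℚ ≤ a → 0ℚ ≤ b → a + b ≡ 0ℚ → b ≡ 0ℚ
+-nonneg-zeroʳ {a} {b} 0≤a 0≤b a+b≡0 = +-nonneg-zeroˡ 0≤b 0≤a (trans (ℚ.+-comm b a) a+b≡0)

sumFin-nonneg : ∀ {n} (f : Fin n → ℚ) → (∀ i → 0ℚ ≤ f i) → 0ℚ ≤ sumFin f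
sumFin-nonneg {zero}  f 0≤f = ℚ.≤-refl
sumFin-nonneg {suc n} f 0≤f =
  ℚ.≤-trans (ℚ.≤-reflexive (sym (ℚ.+-identityʳ 0ℚ))) (ℚ.+-mono-≤ (0≤f zero) (sumFin-nonneg (f ∘ suc) (0≤f ∘ suc)))

sumFin-nonneg-zero : ∀ {n} (f : Fin n → ℚ) → (∀ i → 0ℚ ≤ f i) → sumFin f ≡ 0ℚ → ∀ i → f i ≡ 0ℚ
sumFin-nonneg-zero {suc n} f 0≤f Σf≡0 zero =
  +-nonneg-zeroˡ (0≤f zero) (sumFin-nonneg (f ∘ suc) (0≤f ∘ suc)) Σf≡0
sumFin-nonneg-zero {suc n} f 0≤f Σf≡0 (suc i) =
  sumFin-nonneg-zero (f ∘ suc) (0≤f ∘ suc)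
    (+-nonneg-zeroʳ (0≤f zero) (sumFin-nonneg (f ∘ suc) (0≤f ∘ suc)) Σf≡0) i

square-nonneg : ∀ x → 0ℚ ≤ x * x
square-nonneg x with ℚ.≤-total 0ℚ x
... | inj₁ 0≤x = ℚ.nonNegative⁻¹ _ {{ℚ.nonNeg*nonNeg⇒nonNeg x {{ℚ.nonNegative 0≤x}} x {{ℚ.nonNegative 0≤x}}}}
... | inj₂ x≤0 = ℚ.nonNegative⁻¹ _ {{ℚ.nonPos*nonPos⇒nonPos x {{ℚ.nonPositive x≤0}} x {{ℚ.nonPositive x≤0}}}}

square-zero : ∀ x → x * x ≡ 0ℚ → x ≡ 0ℚ
square-zero x x²≡0 with ℚ.<-cmp x 0ℚ
... | tri≈ _ x≡0 _ = x≡0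
... | tri< x<0 _ _ =
  contradiction (sym x²≡0) (ℚ.<⇒≢ (ℚ.positive⁻¹ _ {{ℚ.neg*neg⇒pos x {{ℚ.negative x<0}} x {{ℚ.negative x<0}}}}))
... | tri> _ _ x>0 =
  contradiction (sym x²≡0) (ℚ.<⇒≢ (ℚ.positive⁻¹ _ {{ℚ.pos*pos⇒pos x {{ℚ.positive x>0}} x {{ℚ.positive x>0}}}}))

sumFin-squares-zero : ∀ {n} (f : Fin n → ℚ) → sumFin (λ i → f i * f i) ≡ 0ℚ → ∀ i → f i ≡ 0ℚ
sumFin-squares-zero f Σf²≡0 i = square-zero (f i) (sumFin-nonneg-zero _ (λ j → square-nonneg (f j)) Σf²≡0 i)

≡-neg⇒≡0 : ∀ x → x ≡ - x → x ≡ 0ℚ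
≡-neg⇒≡0 x x≡-x with ℚ.<-cmp x 0ℚ
... | tri≈ _ x≡0 _ = x≡0
... | tri< x<0 _ _ = contradiction (subst (0ℚ <_) (sym x≡-x) (ℚ.neg-antimono-< x<0)) (ℚ.<-asym x<0)
... | tri> _ _ x>0 = contradiction (subst (_< 0ℚ) (sym x≡-x) (ℚ.neg-antimono-< x>0)) (ℚ.<-asym x>0)

sumFin-indicator-zero : ∀ {n} (P : Fin n → Bool) → sumFin (indicator ∘ P) ≡ 0ℚ → ∀ i → P i ≡ false
sumFin-indicator-zero P ΣP≡0 i = indicator-zero (P i) (sumFin-nonneg-zero _ (indicator-nonneg ∘ P) ΣP≡0 i)
  where
  indicator-nonneg : ∀ b → 0ℚ ≤ indicator b
  indicator-nonneg true  = ℚ.nonNegative⁻¹ 1ℚ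
  indicator-nonneg false = ℚ.≤-refl
  indicator-zero : ∀ b → indicator b ≡ 0ℚ → b ≡ false
  indicator-zero false _ = refl

sumFin-indicator-true : ∀ {n} (P : Fin n → Bool) b → sumFin (indicator ∘ P) ≡ indicator b →
                        ∀ k → P k ≡ true → b ≡ true
sumFin-indicator-true P true  _    k _  = refl
sumFin-indicator-true P false ΣP≡0 k Pk = contradiction (trans (sym Pk) (sumFin-indicator-zero P ΣP≡0 k)) true≢false

sumFin-indicator-one : ∀ {n} (P : Fin n → Bool) k → P k ≡ true → sumFin (indicator ∘ P) ≡ 1ℚ →
                       ∀ i → P i ≡ true → i ≡ k
sumFin-indicator-one {suc n} P k Pk ΣP≡1 i Pi with i ≟ k
... | yes i≡k = i≡k
... | no  i≢k = contradiction (trans (sym Pi) Pi≡false) λ ()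
  where
  rest≡0 : sumFin (indicator ∘ P ∘ punchIn k) ≡ 0ℚ
  rest≡0 = identityʳ-unique 1ℚ _ (begin
    1ℚ + sumFin (indicator ∘ P ∘ punchIn k)      ≡⟨ cong (λ b → indicator b + sumFin (indicator ∘ P ∘ punchIn k)) Pk ⟨
    indicator (P k) + sumFin (indicator ∘ P ∘ punchIn k) ≡⟨ sumFin-remove k (indicator ∘ P) ⟨
    sumFin (indicator ∘ P)                       ≡⟨ ΣP≡1 ⟩
    1ℚ                                           ∎)
    where open ≡-Reasoning
  Pi≡false : P i ≡ false
  Pi≡false = subst (λ j → P j ≡ false) (Fin.punchIn-punchOut (i≢k ∘ sym))
                   (sumFin-indicator-zero (P ∘ punchIn k) rest≡0 (punchOut (i≢k ∘ sym)))

-- Kernels and nullity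

Matrix : ℕ → ℕ → Set
Matrix r m = Fin r → Fin m → ℚ

apply : ∀ {r m} → Matrix r m → (Fin m → ℚ) → Fin r → ℚ
apply M x i = sumFin (λ j → M i j * x j)

gram : ∀ {r m} → Matrix r m → Matrix m m
gram M e f = sumFin (λ w → M w e * M w f)

transpose : ∀ {r m} → Matrix r m → Matrix m r
transpose M i j = M j i

apply-cong : ∀ {r m} (M : Matrix r m) {x y} → (∀ e → x e ≡ y e) → ∀ i → apply M x i ≡ apply M y i
apply-cong M x≗y i = sumFin-cong (λ e → cong (M i e *_) (x≗y e))

gram-apply : ∀ {r m} (M : Matrix r m) x e → apply (gram M) x e ≡ sumFin (λ w → M w e * apply M x w)
gram-apply M x e = begin
  sumFin (λ f → sumFin (λ w → M w e * M w f) * x f)   ≡⟨ sumFin-cong (λ f → *-distribʳ-sumFin (x f) (λ w → M w e * M w f)) ⟩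
  sumFin (λ f → sumFin (λ w → M w e * M w f * x f))   ≡⟨ sumFin-comm (λ f w → M w e * M w f * x f) ⟩
  sumFin (λ w → sumFin (λ f → M w e * M w f * x f))   ≡⟨ sumFin-cong (λ w → sumFin-cong (λ f → ℚ.*-assoc (M w e) (M w f) (x f))) ⟩
  sumFin (λ w → sumFin (λ f → M w e * (M w f * x f))) ≡⟨ sumFin-cong (λ w → *-distribˡ-sumFin (M w e) (λ f → M w f * x f)) ⟨
  sumFin (λ w → M w e * apply M x w)                  ∎
  where open ≡-Reasoning

gram-quadratic : ∀ {r m} (M : Matrix r m) x →
                 sumFin (λ e → x e * apply (gram M) x e) ≡ sumFin (λ w → apply M x w * apply M x w)
gram-quadratic M x = begin
  sumFin (λ e → x e * apply (gram M) x e)               ≡⟨ sumFin-cong (λ e → cong (x e *_) (gram-apply M x e)) ⟩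
  sumFin (λ e → x e * sumFin (λ w → M w e * Mx w))      ≡⟨ sumFin-cong (λ e → *-distribˡ-sumFin (x e) (λ w → M w e * Mx w)) ⟩
  sumFin (λ e → sumFin (λ w → x e * (M w e * Mx w)))    ≡⟨ sumFin-comm (λ e w → x e * (M w e * Mx w)) ⟩
  sumFin (λ w → sumFin (λ e → x e * (M w e * Mx w)))    ≡⟨ sumFin-cong (λ w → sumFin-cong (λ e → reorder (x e) (M w e) (Mx w))) ⟩
  sumFin (λ w → sumFin (λ e → M w e * x e * Mx w))      ≡⟨ sumFin-cong (λ w → *-distribʳ-sumFin (Mx w) (λ e → M w e * x e)) ⟨
  sumFin (λ w → Mx w * Mx w)                            ∎
  where
  open ≡-Reasoning
  Mx = apply M x
  reorder : ∀ a b c → a * (b * c) ≡ b * a * c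
  reorder = solve 3 (λ a b c → a :* (b :* c) := b :* a :* c) refl

apply-+ : ∀ {m} (M N : Matrix m m) x e → apply (λ i j → M i j + N i j) x e ≡ apply M x e + apply N x e
apply-+ M N x e =
  trans (sumFin-cong (λ f → ℚ.*-distribʳ-+ (x f) (M e f) (N e f))) (sumFin-+ (λ f → M e f * x f) (λ f → N e f * x f))

gram-+-quadratic : ∀ {p q m} (M : Matrix p m) (N : Matrix q m) x →
                   sumFin (λ e → x e * apply (λ e f → gram M e f + gram N e f) x e) ≡
                   sumFin (λ w → apply M x w * apply M x w) + sumFin (λ T → apply N x T * apply N x T)
gram-+-quadratic M N x = begin
  sumFin (λ e → x e * apply (λ e f → gram M e f + gram N e f) x e)
    ≡⟨ sumFin-cong (λ e → cong (x e *_) (apply-+ (gram M) (gram N) x e)) ⟩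
  sumFin (λ e → x e * (apply (gram M) x e + apply (gram N) x e))
    ≡⟨ sumFin-cong (λ e → ℚ.*-distribˡ-+ (x e) (apply (gram M) x e) (apply (gram N) x e)) ⟩
  sumFin (λ e → x e * apply (gram M) x e + x e * apply (gram N) x e)
    ≡⟨ sumFin-+ (λ e → x e * apply (gram M) x e) (λ e → x e * apply (gram N) x e) ⟩
  sumFin (λ e → x e * apply (gram M) x e) + sumFin (λ e → x e * apply (gram N) x e)
    ≡⟨ cong₂ _+_ (gram-quadratic M x) (gram-quadratic N x) ⟩
  sumFin (λ w → apply M x w * apply M x w) + sumFin (λ T → apply N x T * apply N x T) ∎
  where open ≡-Reasoning

InKer-gram-+ : ∀ {p q m} (M : Matrix p m) (N : Matrix q m) x →
               InKer (λ e f → gram M e f + gram N e f) x ⇔ ((∀ w → apply M x w ≡ 0ℚ) × (∀ T → apply N x T ≡ 0ℚ))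
InKer-gram-+ M N x = mk⇔ to from
  where
  Mx = apply M x
  Nx = apply N x
  to : InKer (λ e f → gram M e f + gram N e f) x → (∀ w → Mx w ≡ 0ℚ) × (∀ T → Nx T ≡ 0ℚ)
  to Hx≡0 = sumFin-squares-zero Mx (+-nonneg-zeroˡ |Mx|²≥0 |Nx|²≥0 squares≡0) ,
            sumFin-squares-zero Nx (+-nonneg-zeroʳ |Mx|²≥0 |Nx|²≥0 squares≡0)
    where
    |Mx|²≥0 = sumFin-nonneg _ (λ w → square-nonneg (Mx w))
    |Nx|²≥0 = sumFin-nonneg _ (λ T → square-nonneg (Nx T))
    squares≡0 : sumFin (λ w → Mx w * Mx w) + sumFin (λ T → Nx T * Nx T) ≡ 0ℚ
    squares≡0 = trans (sym (gram-+-quadratic M N x))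
                      (sumFin-zero (λ e → trans (cong (x e *_) (Hx≡0 e)) (ℚ.*-zeroʳ (x e))))
  from : (∀ w → Mx w ≡ 0ℚ) × (∀ T → Nx T ≡ 0ℚ) → InKer (λ e f → gram M e f + gram N e f) x
  from (Mx≡0 , Nx≡0) e = begin
    apply (λ e f → gram M e f + gram N e f) x e                  ≡⟨ apply-+ (gram M) (gram N) x e ⟩
    apply (gram M) x e + apply (gram N) x e                      ≡⟨ cong₂ _+_ (gram-apply M x e) (gram-apply N x e) ⟩
    sumFin (λ w → M w e * Mx w) + sumFin (λ T → N T e * Nx T)   ≡⟨ cong₂ _+_ (sumFin-zero (λ w → vanish (M w e) (Mx≡0 w)))
                                                                                  (sumFin-zero (λ T → vanish (N T e) (Nx≡0 T))) ⟩
    0ℚ + 0ℚ                                                      ∎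
    where
    open ≡-Reasoning
    vanish : ∀ a {b} → b ≡ 0ℚ → a * b ≡ 0ℚ
    vanish a refl = ℚ.*-zeroʳ a

combination : ∀ {k m} → (Fin k → ℚ) → (Fin k → Fin m → ℚ) → Fin m → ℚ
combination c vs j = sumFin (λ i → c i * vs i j)

sumFin-combination : ∀ {k n} (c : Fin k → ℚ) (g : Fin k → Fin n → ℚ) →
                     sumFin (λ e → combination c g e) ≡ sumFin (λ i → c i * sumFin (g i))
sumFin-combination c g =
  trans (sumFin-comm (λ e i → c i * g i e)) (sumFin-cong (λ i → sym (*-distribˡ-sumFin (c i) (g i))))

when-combination : ∀ {k} b (c : Fin k → ℚ) (x : Fin k → ℚ) →
                   when b (sumFin (λ i → c i * x i)) ≡ sumFin (λ i → c i * when b (x i))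
when-combination b c x =
  trans (when-distrib-sumFin b (λ i → c i * x i)) (sumFin-cong (λ i → when-*ˡ b (c i) (x i)))

combination-sub : ∀ {k} (c : Fin k → ℚ) (x y : Fin k → ℚ) →
                  sumFin (λ i → c i * x i) + - sumFin (λ i → c i * y i) ≡ sumFin (λ i → c i * (x i + - y i))
combination-sub c x y = begin
  sumFin (λ i → c i * x i) + - sumFin (λ i → c i * y i) ≡⟨ sumFin-sub (λ i → c i * x i) (λ i → c i * y i) ⟨
  sumFin (λ i → c i * x i + - (c i * y i))               ≡⟨ sumFin-cong (λ i → distrib (c i) (x i) (y i)) ⟩
  sumFin (λ i → c i * (x i + - y i))                     ∎
  where
  open ≡-Reasoning
  distrib : ∀ a p q → a * p + - (a * q) ≡ a * (p + - q)
  distrib = solve 3 (λ a p q → a :* p :+ :- (a :* q) := a :* (p :+ :- q)) refl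

-- Linearity is stated up to pointwise equality of the input, which a map on functions need not respect.
IsLinear : ∀ {m m′} → ((Fin m → ℚ) → Fin m′ → ℚ) → Set
IsLinear {m} F = ∀ {k} (c : Fin k → ℚ) (vs : Fin k → Fin m → ℚ) z →
                 (∀ e → z e ≡ combination c vs e) → ∀ j → F z j ≡ combination c (F ∘ vs) j

IsLinear-zero : ∀ {m m′} {F : (Fin m → ℚ) → Fin m′ → ℚ} → IsLinear F →
                ∀ z → (∀ e → z e ≡ 0ℚ) → ∀ j → F z j ≡ 0ℚ
IsLinear-zero F-linear z z≡0 = F-linear {zero} (λ ()) (λ ()) z z≡0

record KernelIso {m m′} (M : Matrix m m) (M′ : Matrix m′ m′) : Set where
  field
    to          : (Fin m → ℚ) → Fin m′ → ℚ
    from        : (Fin m′ → ℚ) → Fin m → ℚ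
    to-linear   : IsLinear to
    from-linear : IsLinear from
    to-kernel   : ∀ x → InKer M x → InKer M′ (to x)
    from-kernel : ∀ y → InKer M′ y → InKer M (from y)
    from∘to     : ∀ x → InKer M x → ∀ e → from (to x) e ≡ x e
    to∘from     : ∀ y → InKer M′ y → ∀ e → to (from y) e ≡ y e

KernelIso-sym : ∀ {m m′} {M : Matrix m m} {M′ : Matrix m′ m′} → KernelIso M M′ → KernelIso M′ M
KernelIso-sym iso = record
  { to = from ; from = to ; to-linear = from-linear ; from-linear = to-linear
  ; to-kernel = from-kernel ; from-kernel = to-kernel ; from∘to = to∘from ; to∘from = from∘to }
  where open KernelIso iso

LinIndep-to : ∀ {m m′} {M : Matrix m m} {M′ : Matrix m′ m′} (iso : KernelIso M M′) →
              ∀ {k} (vs : Fin k → Fin m → ℚ) → (∀ i → InKer M (vs i)) → LinIndep vs →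
              LinIndep (KernelIso.to iso ∘ vs)
LinIndep-to iso vs vs∈ker vs-indep c Σc·to[vs]≡0 = vs-indep c Σc·vs≡0
  where
  open KernelIso iso
  open ≡-Reasoning
  Σc·vs≡0 : ∀ e → combination c vs e ≡ 0ℚ
  Σc·vs≡0 e = begin
    combination c vs e                   ≡⟨ sumFin-cong (λ i → cong (c i *_) (from∘to (vs i) (vs∈ker i) e)) ⟨
    combination c (from ∘ to ∘ vs) e     ≡⟨ from-linear c (to ∘ vs) _ (λ _ → refl) e ⟨
    from (combination c (to ∘ vs)) e     ≡⟨ IsLinear-zero from-linear _ Σc·to[vs]≡0 e ⟩
    0ℚ                                   ∎

HasNullity-to : ∀ {m m′} {M : Matrix m m} {M′ : Matrix m′ m′} → KernelIso M M′ →
                ∀ {k} → HasNullity M k → HasNullity M′ k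
HasNullity-to iso ((vs , vs∈ker , vs-indep) , maximal) =
  (to ∘ vs , (λ i → to-kernel (vs i) (vs∈ker i)) , LinIndep-to iso vs vs∈ker vs-indep) ,
  λ ws ws∈ker ws-indep → maximal (from ∘ ws) (λ i → from-kernel (ws i) (ws∈ker i))
                                  (LinIndep-to (KernelIso-sym iso) ws ws∈ker ws-indep)
  where open KernelIso iso

HasNullity-⇔ : ∀ {m m′} {M : Matrix m m} {M′ : Matrix m′ m′} → KernelIso M M′ →
               ∀ k → HasNullity M k ⇔ HasNullity M′ k
HasNullity-⇔ iso k = mk⇔ (HasNullity-to iso) (HasNullity-to (KernelIso-sym iso))

-- Edge vectors and flows

sumList : ∀ {A : Set} → (A → ℚ) → List A → ℚ
sumList g []       = 0ℚ
sumList g (x ∷ xs) = g x + sumList g xs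

sumFin-lookup : ∀ {A : Set} (xs : List A) (g : A → ℚ) → sumFin (g ∘ lookup xs) ≡ sumList g xs
sumFin-lookup []       g = refl
sumFin-lookup (x ∷ xs) g = cong (g x +_) (sumFin-lookup xs g)

sumList-++ : ∀ {A : Set} (g : A → ℚ) xs ys → sumList g (xs ++ ys) ≡ sumList g xs + sumList g ys
sumList-++ g []       ys = sym (ℚ.+-identityˡ _)
sumList-++ g (x ∷ xs) ys = trans (cong (g x +_) (sumList-++ g xs ys)) (sym (ℚ.+-assoc (g x) _ _))

sumList-concat : ∀ {A : Set} (g : A → ℚ) xss → sumList g (concat xss) ≡ sumList (sumList g) xss
sumList-concat g []         = refl
sumList-concat g (xs ∷ xss) = trans (sumList-++ g xs (concat xss)) (cong (sumList g xs +_) (sumList-concat g xss))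

sumList-tabulate : ∀ {A : Set} {n} (g : A → ℚ) (f : Fin n → A) → sumList g (tabulate f) ≡ sumFin (g ∘ f)
sumList-tabulate {n = zero}  g f = refl
sumList-tabulate {n = suc n} g f = cong (g (f zero) +_) (sumList-tabulate g (f ∘ suc))

sumList-concatMap-allFin : ∀ {A : Set} {n} (F : Fin n → List A) (g : A → ℚ) →
                           sumList g (concat (map F (allFin n))) ≡ sumFin (sumList g ∘ F)
sumList-concatMap-allFin {n = n} F g = begin
  sumList g (concat (map F (allFin n)))   ≡⟨ sumList-concat g (map F (allFin n)) ⟩
  sumList (sumList g) (map F (allFin n))  ≡⟨ cong (sumList (sumList g)) (List.map-tabulate id F) ⟩
  sumList (sumList g) (tabulate F)        ≡⟨ sumList-tabulate (sumList g) F ⟩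
  sumFin (sumList g ∘ F)                  ∎
  where open ≡-Reasoning

sumList-if-singleton : ∀ {A : Set} (g : A → ℚ) b p → sumList g (if b then [ p ] else []) ≡ when b (g p)
sumList-if-singleton g true  p = ℚ.+-identityʳ (g p)
sumList-if-singleton g false p = refl

isArc : ∀ {N} → Graph N → Fin N → Fin N → Bool
isArc G i j = (i <F j) ∧ adj G i j

isTriangle : ∀ {N} → Graph N → Fin N → Fin N → Fin N → Bool
isTriangle G i j k = (i <F j) ∧ (j <F k) ∧ adj G i j ∧ adj G j k ∧ adj G i k

sumFin-edges : ∀ {N} (G : Graph N) (g : Fin N × Fin N → ℚ) →
               sumFin (g ∘ edgeAt G) ≡ sumFin (λ i → sumFin (λ j → when (isArc G i j) (g (i , j))))
sumFin-edges {N} G g = begin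
  sumFin (g ∘ edgeAt G)
    ≡⟨ sumFin-lookup (edges G) g ⟩
  sumList g (concat (map (λ i → concat (map (arcs i) (allFin N))) (allFin N)))
    ≡⟨ sumList-concatMap-allFin (λ i → concat (map (arcs i) (allFin N))) g ⟩
  sumFin (λ i → sumList g (concat (map (arcs i) (allFin N))))
    ≡⟨ sumFin-cong (λ i → sumList-concatMap-allFin (arcs i) g) ⟩
  sumFin (λ i → sumFin (λ j → sumList g (arcs i j)))
    ≡⟨ sumFin-cong (λ i → sumFin-cong (λ j → sumList-if-singleton g (isArc G i j) (i , j))) ⟩
  sumFin (λ i → sumFin (λ j → when (isArc G i j) (g (i , j)))) ∎
  where
  open ≡-Reasoning
  arcs : Fin N → Fin N → List (Fin N × Fin N)
  arcs i j = if isArc G i j then [ (i , j) ] else []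

sumFin-triangles : ∀ {N} (G : Graph N) (g : Triple N → ℚ) →
                   sumFin (g ∘ triAt G) ≡
                   sumFin (λ i → sumFin (λ j → sumFin (λ k → when (isTriangle G i j k) (g (i , j , k)))))
sumFin-triangles {N} G g = begin
  sumFin (g ∘ triAt G)
    ≡⟨ sumFin-lookup (triangles G) g ⟩
  sumList g (concat (map (λ i → concat (map (λ j → concat (map (tris i j) (allFin N))) (allFin N))) (allFin N)))
    ≡⟨ sumList-concatMap-allFin (λ i → concat (map (λ j → concat (map (tris i j) (allFin N))) (allFin N))) g ⟩
  sumFin (λ i → sumList g (concat (map (λ j → concat (map (tris i j) (allFin N))) (allFin N))))
    ≡⟨ sumFin-cong (λ i → sumList-concatMap-allFin (λ j → concat (map (tris i j) (allFin N))) g) ⟩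
  sumFin (λ i → sumFin (λ j → sumList g (concat (map (tris i j) (allFin N)))))
    ≡⟨ sumFin-cong (λ i → sumFin-cong (λ j → sumList-concatMap-allFin (tris i j) g)) ⟩
  sumFin (λ i → sumFin (λ j → sumFin (λ k → sumList g (tris i j k))))
    ≡⟨ sumFin-cong (λ i → sumFin-cong (λ j → sumFin-cong (λ k →
         sumList-if-singleton g (isTriangle G i j k) (i , j , k)))) ⟩
  sumFin (λ i → sumFin (λ j → sumFin (λ k → when (isTriangle G i j k) (g (i , j , k))))) ∎
  where
  open ≡-Reasoning
  tris : Fin N → Fin N → Fin N → List (Triple N)
  tris i j k = if isTriangle G i j k then [ (i , j , k) ] else []

<F⇒< : ∀ {n} (a b : Fin n) → (a <F b) ≡ true → toℕ a ℕ.< toℕ b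
<F⇒< a b a<b = ℕ.<ᵇ⇒< (toℕ a) (toℕ b) (subst T (sym a<b) tt)

<⇒<F : ∀ {n} (a b : Fin n) → toℕ a ℕ.< toℕ b → (a <F b) ≡ true
<⇒<F a b a<b = Equivalence.to Bool.T-≡ (ℕ.<⇒<ᵇ a<b)

<F-irrefl : ∀ {n} {a : Fin n} → (a <F a) ≡ true → ⊥
<F-irrefl {a = a} a<a = ℕ.<-irrefl refl (<F⇒< a a a<a)

<F-asym : ∀ {n} {a b : Fin n} → (a <F b) ≡ true → (b <F a) ≡ true → ⊥
<F-asym {a = a} {b} a<b b<a = ℕ.<-asym (<F⇒< a b a<b) (<F⇒< b a b<a)

<F-trans : ∀ {n} {a b c : Fin n} → (a <F b) ≡ true → (b <F c) ≡ true → (a <F c) ≡ true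
<F-trans {a = a} {b} {c} a<b b<c = <⇒<F a c (ℕ.<-trans (<F⇒< a b a<b) (<F⇒< b c b<c))

<F-asym-false : ∀ {n} {a b : Fin n} → (a <F b) ≡ true → (b <F a) ≡ false
<F-asym-false {a = a} {b} a<b with b <F a in b<a
... | true  = ⊥-elim (<F-asym {a = a} {b} a<b b<a)
... | false = refl

<F-trichotomy : ∀ {n} (a b : Fin n) → (a <F b) ≡ true ⊎ (b <F a) ≡ true ⊎ a ≡ b
<F-trichotomy a b with ℕ.<-cmp (toℕ a) (toℕ b)
... | tri< a<b _ _ = inj₁ (<⇒<F a b a<b)
... | tri≈ _ a≡b _ = inj₂ (inj₂ (Fin.toℕ-injective a≡b))
... | tri> _ _ b<a = inj₂ (inj₁ (<⇒<F b a b<a))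

adj⇒≢ : ∀ {N} (G : Graph N) {a b} → adj G a b ≡ true → a ≢ b
adj⇒≢ G {a} a~b refl = true≢false (trans (sym a~b) (adj-irrefl G a))

adj-flip : ∀ {N} (G : Graph N) {a b} → adj G a b ≡ true → adj G b a ≡ true
adj-flip G {a} {b} a~b = trans (adj-sym G b a) a~b

adj-flip-false : ∀ {N} (G : Graph N) {a b} → adj G a b ≡ false → adj G b a ≡ false
adj-flip-false G {a} {b} a≁b = trans (adj-sym G b a) a≁b

Flow : ℕ → Set
Flow N = Fin N → Fin N → ℚ

IsAntisymmetric : ∀ {N} → Flow N → Set
IsAntisymmetric X = ∀ a b → X a b ≡ - X b a

IsSupportedOn : ∀ {N} → Graph N → Flow N → Set
IsSupportedOn G X = ∀ a b → adj G a b ≡ false → X a b ≡ 0ℚ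

flowCombination : ∀ {k N} → (Fin k → ℚ) → (Fin k → Flow N) → Flow N
flowCombination c Xs a b = sumFin (λ i → c i * Xs i a b)

IsFlowLinear : ∀ {N N′} → (Flow N → Flow N′) → Set
IsFlowLinear {N} F = ∀ {k} (c : Fin k → ℚ) (Xs : Fin k → Flow N) Z →
                     (∀ a b → Z a b ≡ flowCombination c Xs a b) → ∀ a b → F Z a b ≡ flowCombination c (F ∘ Xs) a b

circulation : ∀ {N} → Flow N → Fin N → Fin N → Fin N → ℚ
circulation X i j k = X i j + X j k + X k i

circulation-rotate : ∀ {N} (X : Flow N) a b c → circulation X a b c ≡ 0ℚ → circulation X b c a ≡ 0ℚ
circulation-rotate X a b c abc≡0 =
  trans (solve 3 (λ x y z → y :+ z :+ x := x :+ y :+ z) refl (X a b) (X b c) (X c a)) abc≡0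

circulation-swap : ∀ {N} (X : Flow N) → IsAntisymmetric X → ∀ a b c → circulation X a b c ≡ 0ℚ → circulation X b a c ≡ 0ℚ
circulation-swap X X-anti a b c abc≡0 = begin
  X b a + X a c + X c b        ≡⟨ cong₂ _+_ (cong₂ _+_ (X-anti b a) (X-anti a c)) (X-anti c b) ⟩
  - X a b + - X c a + - X b c  ≡⟨ solve 3 (λ x y z → :- x :+ :- z :+ :- y := :- (x :+ y :+ z)) refl (X a b) (X b c) (X c a) ⟩
  - circulation X a b c        ≡⟨ cong -_ abc≡0 ⟩
  0ℚ                           ∎
  where open ≡-Reasoning

record IsHarmonic {N} (G : Graph N) (X : Flow N) : Set where
  field
    antisym          : IsAntisymmetric X
    supported        : IsSupportedOn G X
    divergence-free  : ∀ w → sumFin (X w) ≡ 0ℚ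
    circulation-free : ∀ i j k → adj G i j ≡ true → adj G j k ≡ true → adj G i k ≡ true →
                       circulation X i j k ≡ 0ℚ

restrictedFlow : ∀ {N} → Flow N → (Fin N → Bool) → (Fin N → Bool) → ℚ
restrictedFlow X S T = sumFin₂ (λ s t → when (S s) (when (T t) (X s t)))

flux : ∀ {N} → Flow N → (Fin N → Bool) → ℚ
flux X S = restrictedFlow X S (not ∘ S)

restrictedFlow-antisym : ∀ {N} (X : Flow N) → IsAntisymmetric X → ∀ S → restrictedFlow X S S ≡ 0ℚ
restrictedFlow-antisym X X-anti S = ≡-neg⇒≡0 (restrictedFlow X S S) (begin
  restrictedFlow X S S                                 ≡⟨ sumFin-comm (λ s t → when (S s) (when (S t) (X s t))) ⟩
  sumFin₂ (λ t s → when (S s) (when (S t) (X s t)))    ≡⟨ sumFin-cong (λ t → sumFin-cong (λ s → flip t s)) ⟩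
  sumFin₂ (λ t s → - when (S t) (when (S s) (X t s)))  ≡⟨ sumFin₂-neg (λ t s → when (S t) (when (S s) (X t s))) ⟩
  - restrictedFlow X S S                               ∎)
  where
  open ≡-Reasoning
  flip : ∀ t s → when (S s) (when (S t) (X s t)) ≡ - when (S t) (when (S s) (X t s))
  flip t s = begin
    when (S s) (when (S t) (X s t))     ≡⟨ when-comm (S s) (S t) (X s t) ⟩
    when (S t) (when (S s) (X s t))     ≡⟨ cong (λ x → when (S t) (when (S s) x)) (X-anti s t) ⟩
    when (S t) (when (S s) (- X t s))   ≡⟨ cong (when (S t)) (when-neg (S s) (X t s)) ⟩
    when (S t) (- when (S s) (X t s))   ≡⟨ when-neg (S t) (when (S s) (X t s)) ⟩
    - when (S t) (when (S s) (X t s))   ∎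

-- The flow inside S cancels by antisymmetry, so the divergence summed over S is the flux out of S.
flux-zero : ∀ {N} (X : Flow N) → IsAntisymmetric X → (∀ w → sumFin (X w) ≡ 0ℚ) → ∀ S → flux X S ≡ 0ℚ
flux-zero X X-anti X-div S = begin
  flux X S                                   ≡⟨ ℚ.+-identityˡ (flux X S) ⟨
  0ℚ + flux X S                              ≡⟨ cong (_+ flux X S) (restrictedFlow-antisym X X-anti S) ⟨
  restrictedFlow X S S + flux X S            ≡⟨ sumFin₂-+ (λ s t → when (S s) (when (S t) (X s t)))
                                                          (λ s t → when (S s) (when (not (S t)) (X s t))) ⟨
  sumFin₂ (λ s t → when (S s) (when (S t) (X s t)) + when (S s) (when (not (S t)) (X s t)))
                                             ≡⟨ sumFin-cong (λ s → sumFin-cong (λ t → split (S s) (S t) (X s t))) ⟩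
  sumFin₂ (λ s t → when (S s) (X s t))       ≡⟨ sumFin-cong (λ s → when-distrib-sumFin (S s) (X s)) ⟨
  sumFin (λ s → when (S s) (sumFin (X s)))   ≡⟨ sumFin-zero (λ s → trans (cong (when (S s)) (X-div s)) (when-zero (S s))) ⟩
  0ℚ                                         ∎
  where
  open ≡-Reasoning
  split : ∀ a b x → when a (when b x) + when a (when (not b) x) ≡ when a x
  split false b     x = refl
  split true  true  x = ℚ.+-identityʳ x
  split true  false x = ℚ.+-identityˡ x

-- The entries of 𝓑 and 𝓒: 𝓑 G e w is definitionally incidence (edgeAt G e) w,
-- and 𝓒 G T e is triangleSign (triAt G T) (edgeAt G e).
incidence : ∀ {N} → Fin N × Fin N → Fin N → ℚ
incidence (t , h) w = if w == t then - 1ℚ else (if w == h then 1ℚ else 0ℚ)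

incidence-* : ∀ {N} (i j w : Fin N) x → i ≢ j → incidence (i , j) w * x ≡ when (w == j) x + - when (w == i) x
incidence-* i j w x i≢j = signed (w == i) (w == j) (λ w≡i w≡j → i≢j (trans (sym (==⇒≡ w≡i)) (==⇒≡ w≡j)))
  where
  signed : ∀ s t → (s ≡ true → t ≡ true → ⊥) →
           (if s then - 1ℚ else (if t then 1ℚ else 0ℚ)) * x ≡ when t x + - when s x
  signed true  true  excl = ⊥-elim (excl refl refl)
  signed true  false _    = trans (sym (ℚ.neg-distribˡ-* 1ℚ x)) (trans (cong -_ (ℚ.*-identityˡ x)) (sym (ℚ.+-identityˡ (- x))))
  signed false true  _    = trans (ℚ.*-identityˡ x) (sym (ℚ.+-identityʳ x))
  signed false false _    = ℚ.*-zeroˡ x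

triangleSign : ∀ {N} → Triple N → Fin N × Fin N → ℚ
triangleSign t (a , b) = if inPlus t (a , b) then 1ℚ else (if inPlus t (b , a) then - 1ℚ else 0ℚ)

triangleSign-sorted : ∀ {N} (p q r i j : Fin N) → (p <F q) ≡ true → (q <F r) ≡ true → (i <F j) ≡ true →
                      triangleSign (p , q , r) (i , j) ≡
                      indicator (pairEq (i , j) p q) + indicator (pairEq (i , j) q r) + - indicator (pairEq (i , j) p r)
triangleSign-sorted p q r i j p<q q<r i<j =
  trans (cong₂ (λ s t → if s then 1ℚ else (if t then - 1ℚ else 0ℚ)) forward backward)
        (signs (pairEq (i , j) p q) (pairEq (i , j) q r) (pairEq (i , j) p r) pq-qr pq-pr qr-pr)
  where
  p<r = <F-trans {a = p} {q} {r} p<q q<r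
  reversed : ∀ a b → (a <F b) ≡ true → j ≡ a → i ≡ b → ⊥
  reversed a b a<b refl refl = <F-asym {a = i} {j} i<j a<b
  distinct : ∀ a b → (a <F b) ≡ true → a ≢ b
  distinct a b a<b refl = <F-irrefl {a = a} a<b
  forward : inPlus (p , q , r) (i , j) ≡ (pairEq (i , j) p q ∨ pairEq (i , j) q r ∨ false)
  forward = cong (λ z → pairEq (i , j) p q ∨ pairEq (i , j) q r ∨ z)
                 (pairEq-false i j r p (λ i≡r j≡p → reversed p r p<r j≡p i≡r))
  backward : inPlus (p , q , r) (j , i) ≡ (false ∨ false ∨ pairEq (i , j) p r)
  backward = trans (cong₂ (λ x y → x ∨ y ∨ pairEq (j , i) r p)
                         (pairEq-false j i p q (λ j≡p i≡q → reversed p q p<q j≡p i≡q))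
                         (pairEq-false j i q r (λ j≡q i≡r → reversed q r q<r j≡q i≡r)))
                   (Bool.∧-comm (j == r) (i == p))
  pq-qr : pairEq (i , j) p q ≡ true → pairEq (i , j) q r ≡ true → ⊥
  pq-qr a b = distinct p q p<q (trans (sym (proj₁ (pairEq⇒≡ i j p q a))) (proj₁ (pairEq⇒≡ i j q r b)))
  pq-pr : pairEq (i , j) p q ≡ true → pairEq (i , j) p r ≡ true → ⊥
  pq-pr a c = distinct q r q<r (trans (sym (proj₂ (pairEq⇒≡ i j p q a))) (proj₂ (pairEq⇒≡ i j p r c)))
  qr-pr : pairEq (i , j) q r ≡ true → pairEq (i , j) p r ≡ true → ⊥
  qr-pr b c = distinct p q p<q (trans (sym (proj₁ (pairEq⇒≡ i j p r c))) (proj₁ (pairEq⇒≡ i j q r b)))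
  signs : ∀ a b c → (a ≡ true → b ≡ true → ⊥) → (a ≡ true → c ≡ true → ⊥) → (b ≡ true → c ≡ true → ⊥) →
          (if a ∨ b ∨ false then 1ℚ else (if false ∨ false ∨ c then - 1ℚ else 0ℚ)) ≡
          indicator a + indicator b + - indicator c
  signs true  true  _     ab _  _  = ⊥-elim (ab refl refl)
  signs true  false true  _  ac _  = ⊥-elim (ac refl refl)
  signs false true  true  _  _  bc = ⊥-elim (bc refl refl)
  signs true  false false _  _  _  = refl
  signs false true  false _  _  _  = refl
  signs false false true  _  _  _  = refl
  signs false false false _  _  _  = refl

module EdgeFlows {N} (G : Graph N) where

  src tgt : Fin (nE G) → Fin N
  src = proj₁ ∘ edgeAt G
  tgt = proj₂ ∘ edgeAt G

  count-edges : ∀ a b → sumFin (λ e → indicator (pairEq (edgeAt G e) a b)) ≡ indicator (isArc G a b)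
  count-edges a b = begin
    sumFin (λ e → indicator (pairEq (edgeAt G e) a b))
      ≡⟨ sumFin-edges G (λ q → indicator (pairEq q a b)) ⟩
    sumFin (λ i → sumFin (λ j → when (isArc G i j) (indicator ((i == a) ∧ (j == b)))))
      ≡⟨ sumFin-cong (λ i → sumFin-cong (λ j → when-comm (isArc G i j) ((i == a) ∧ (j == b)) 1ℚ)) ⟩
    sumFin (λ i → sumFin (λ j → when ((i == a) ∧ (j == b)) (indicator (isArc G i j))))
      ≡⟨ sumFin-delta₂ a b (λ i j → indicator (isArc G i j)) ⟩
    indicator (isArc G a b) ∎
    where open ≡-Reasoning

  pairEq-self : ∀ e → pairEq (edgeAt G e) (src e) (tgt e) ≡ true
  pairEq-self e = ∧-true⁺ (==-refl (src e)) (==-refl (tgt e))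

  isArc-edge : ∀ e → isArc G (src e) (tgt e) ≡ true
  isArc-edge e = sumFin-indicator-true _ _ (count-edges (src e) (tgt e)) e (pairEq-self e)

  src<tgt : ∀ e → (src e <F tgt e) ≡ true
  src<tgt e = proj₁ (∧-true⁻ (isArc-edge e))

  adj-edge : ∀ e → adj G (src e) (tgt e) ≡ true
  adj-edge e = proj₂ (∧-true⁻ (isArc-edge e))

  edge-unique : ∀ e e′ → pairEq (edgeAt G e′) (src e) (tgt e) ≡ true → e′ ≡ e
  edge-unique e = sumFin-indicator-one (λ e′ → pairEq (edgeAt G e′) (src e) (tgt e)) e (pairEq-self e)
                    (trans (count-edges (src e) (tgt e)) (cong indicator (isArc-edge e)))

  arcValue : (Fin (nE G) → ℚ) → Flow N
  arcValue x a b = sumFin (λ e → when (pairEq (edgeAt G e) a b) (x e))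

  toFlow : (Fin (nE G) → ℚ) → Flow N
  toFlow x a b = arcValue x a b + - arcValue x b a

  fromFlow : Flow N → Fin (nE G) → ℚ
  fromFlow X e = X (src e) (tgt e)

  arcValue-edge : ∀ x e → arcValue x (src e) (tgt e) ≡ x e
  arcValue-edge x e = trans (sumFin-single e _ others) (when-true (x e) (pairEq-self e))
    where
    others : ∀ e′ → e′ ≢ e → when (pairEq (edgeAt G e′) (src e) (tgt e)) (x e′) ≡ 0ℚ
    others e′ e′≢e with pairEq (edgeAt G e′) (src e) (tgt e) in p
    ... | true  = contradiction (edge-unique e e′ p) e′≢e
    ... | false = refl

  arcValue-vanishes : ∀ x a b → (∀ e → src e ≡ a → tgt e ≡ b → ⊥) → arcValue x a b ≡ 0ℚ
  arcValue-vanishes x a b no-edge = sumFin-zero vanish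
    where
    vanish : ∀ e → when (pairEq (edgeAt G e) a b) (x e) ≡ 0ℚ
    vanish e with pairEq (edgeAt G e) a b in p
    ... | false = refl
    ... | true  = let (s≡a , t≡b) = pairEq⇒≡ (src e) (tgt e) a b p in ⊥-elim (no-edge e s≡a t≡b)

  arcValue-reversed : ∀ x e → arcValue x (tgt e) (src e) ≡ 0ℚ
  arcValue-reversed x e = arcValue-vanishes x (tgt e) (src e) λ e′ s≡t t≡s →
    <F-asym {a = src e} {tgt e} (src<tgt e) (subst₂ (λ p q → (p <F q) ≡ true) s≡t t≡s (src<tgt e′))

  arcValue-nonadjacent : ∀ x a b → adj G a b ≡ false → arcValue x a b ≡ 0ℚ
  arcValue-nonadjacent x a b a≁b = arcValue-vanishes x a b λ e s≡a t≡b →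
    true≢false (trans (sym (subst₂ (λ p q → adj G p q ≡ true) s≡a t≡b (adj-edge e))) a≁b)

  fromFlow-toFlow : ∀ x e → fromFlow (toFlow x) e ≡ x e
  fromFlow-toFlow x e =
    trans (cong₂ (λ p q → p + - q) (arcValue-edge x e) (arcValue-reversed x e)) (ℚ.+-identityʳ (x e))

  toFlow-antisym : ∀ x → IsAntisymmetric (toFlow x)
  toFlow-antisym x a b = solve 2 (λ p q → p :+ :- q := :- (q :+ :- p)) refl (arcValue x a b) (arcValue x b a)

  toFlow-supported : ∀ x → IsSupportedOn G (toFlow x)
  toFlow-supported x a b a≁b =
    cong₂ (λ p q → p + - q) (arcValue-nonadjacent x a b a≁b) (arcValue-nonadjacent x b a (adj-flip-false G a≁b))

  onArcs : Flow N → Flow N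
  onArcs X i j = when (isArc G i j) (X i j)

  arcValue-fromFlow : ∀ X a b → arcValue (fromFlow X) a b ≡ onArcs X a b
  arcValue-fromFlow X a b = begin
    arcValue (fromFlow X) a b
      ≡⟨ sumFin-edges G (λ q → when (pairEq q a b) (X (proj₁ q) (proj₂ q))) ⟩
    sumFin₂ (λ i j → when (isArc G i j) (when ((i == a) ∧ (j == b)) (X i j)))
      ≡⟨ sumFin-cong (λ i → sumFin-cong (λ j → when-comm (isArc G i j) ((i == a) ∧ (j == b)) (X i j))) ⟩
    sumFin₂ (λ i j → when ((i == a) ∧ (j == b)) (onArcs X i j))
      ≡⟨ sumFin-delta₂ a b (onArcs X) ⟩
    onArcs X a b ∎
    where open ≡-Reasoning

  onArcs-forward : ∀ X → IsSupportedOn G X → ∀ a b → (a <F b) ≡ true → onArcs X a b ≡ X a b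
  onArcs-forward X X-supp a b a<b with adj G a b in a~b
  ... | true  = when-true (X a b) (∧-true⁺ a<b refl)
  ... | false = trans (when-false (X a b) (Bool.∧-zeroʳ (a <F b))) (sym (X-supp a b a~b))

  onArcs-backward : ∀ (X : Flow N) a b → (a <F b) ≡ true → onArcs X b a ≡ 0ℚ
  onArcs-backward X a b a<b = when-false (X b a) (∧-falseˡ (adj G b a) (<F-asym-false {a = a} {b} a<b))

  onArcs-difference : ∀ X → IsAntisymmetric X → IsSupportedOn G X → ∀ a b → onArcs X a b + - onArcs X b a ≡ X a b
  onArcs-difference X X-anti X-supp a b with <F-trichotomy a b
  ... | inj₁ a<b = trans (cong₂ (λ p q → p + - q) (onArcs-forward X X-supp a b a<b) (onArcs-backward X a b a<b))
                         (ℚ.+-identityʳ (X a b))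
  ... | inj₂ (inj₁ b<a) = begin
    onArcs X a b + - onArcs X b a ≡⟨ cong₂ (λ p q → p + - q) (onArcs-backward X b a b<a) (onArcs-forward X X-supp b a b<a) ⟩
    0ℚ + - X b a                  ≡⟨ ℚ.+-identityˡ (- X b a) ⟩
    - X b a                       ≡⟨ X-anti a b ⟨
    X a b                         ∎
    where open ≡-Reasoning
  ... | inj₂ (inj₂ refl) = trans (cong₂ (λ p q → p + - q) loop≡0 loop≡0) (sym (X-supp a a (adj-irrefl G a)))
    where
    loop≡0 : onArcs X a a ≡ 0ℚ
    loop≡0 = when-false (X a a) (∧-falseʳ (a <F a) (adj-irrefl G a))

  toFlow-fromFlow : ∀ X → IsAntisymmetric X → IsSupportedOn G X → ∀ a b → toFlow (fromFlow X) a b ≡ X a b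
  toFlow-fromFlow X X-anti X-supp a b =
    trans (cong₂ (λ p q → p + - q) (arcValue-fromFlow X a b) (arcValue-fromFlow X b a)) (onArcs-difference X X-anti X-supp a b)

  arcValue-linear : ∀ {k} (c : Fin k → ℚ) ws z → (∀ e → z e ≡ combination c ws e) →
                    ∀ a b → arcValue z a b ≡ sumFin (λ i → c i * arcValue (ws i) a b)
  arcValue-linear c ws z z≡Σ a b = begin
    sumFin (λ e → when (pairEq (edgeAt G e) a b) (z e))
      ≡⟨ sumFin-cong (λ e → cong (when (pairEq (edgeAt G e) a b)) (z≡Σ e)) ⟩
    sumFin (λ e → when (pairEq (edgeAt G e) a b) (combination c ws e))
      ≡⟨ sumFin-cong (λ e → when-combination (pairEq (edgeAt G e) a b) c (λ i → ws i e)) ⟩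
    sumFin (λ e → combination c (λ i e → when (pairEq (edgeAt G e) a b) (ws i e)) e)
      ≡⟨ sumFin-combination c (λ i e → when (pairEq (edgeAt G e) a b) (ws i e)) ⟩
    sumFin (λ i → c i * arcValue (ws i) a b) ∎
    where open ≡-Reasoning

  toFlow-linear : ∀ {k} (c : Fin k → ℚ) ws z → (∀ e → z e ≡ combination c ws e) →
                  ∀ a b → toFlow z a b ≡ flowCombination c (toFlow ∘ ws) a b
  toFlow-linear c ws z z≡Σ a b =
    trans (cong₂ (λ p q → p + - q) (arcValue-linear c ws z z≡Σ a b) (arcValue-linear c ws z z≡Σ b a))
          (combination-sub c (λ i → arcValue (ws i) a b) (λ i → arcValue (ws i) b a))

  onArcs-incidence : ∀ (X : Flow N) w i j → when (isArc G i j) (incidence (i , j) w * X i j) ≡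
                     when (j == w) (when (isArc G i j) (X i j)) + - when (i == w) (when (isArc G i j) (X i j))
  onArcs-incidence X w i j with isArc G i j in arc
  ... | false = sym (cong₂ (λ p q → p + - q) (when-zero (j == w)) (when-zero (i == w)))
  ... | true  = trans (incidence-* i j w (X i j) i≢j)
                      (cong₂ (λ p q → when p (X i j) + - when q (X i j)) (==-sym w j) (==-sym w i))
    where
    i≢j : i ≢ j
    i≢j refl = <F-irrefl {a = i} (proj₁ (∧-true⁻ arc))

  𝓑ᵀ-fromFlow : ∀ X → IsAntisymmetric X → IsSupportedOn G X → ∀ w →
                apply (transpose (𝓑 G)) (fromFlow X) w ≡ - sumFin (X w)
  𝓑ᵀ-fromFlow X X-anti X-supp w = begin
    sumFin (λ e → 𝓑 G e w * fromFlow X e)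
      ≡⟨ sumFin-edges G (λ q → incidence q w * X (proj₁ q) (proj₂ q)) ⟩
    sumFin₂ (λ i j → when (isArc G i j) (incidence (i , j) w * X i j))
      ≡⟨ sumFin-cong (λ i → sumFin-cong (onArcs-incidence X w i)) ⟩
    sumFin₂ (λ i j → when (j == w) (A i j) + - when (i == w) (A i j))
      ≡⟨ sumFin₂-sub (λ i j → when (j == w) (A i j)) (λ i j → when (i == w) (A i j)) ⟩
    sumFin₂ (λ i j → when (j == w) (A i j)) + - sumFin₂ (λ i j → when (i == w) (A i j))
      ≡⟨ cong₂ (λ p q → p + - q) (sumFin-cong (λ i → sumFin-delta w (A i))) row-w ⟩
    sumFin (λ a → A a w) + - sumFin (A w)
      ≡⟨ sumFin-sub (λ a → A a w) (A w) ⟨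
    sumFin (λ a → A a w + - A w a)
      ≡⟨ sumFin-cong (λ a → onArcs-difference X X-anti X-supp a w) ⟩
    sumFin (λ a → X a w)
      ≡⟨ sumFin-cong (λ a → X-anti a w) ⟩
    sumFin (λ a → - X w a)
      ≡⟨ sumFin-neg (X w) ⟩
    - sumFin (X w) ∎
    where
    open ≡-Reasoning
    A = onArcs X
    row-w : sumFin₂ (λ i j → when (i == w) (A i j)) ≡ sumFin (A w)
    row-w = trans (sumFin-cong (λ i → sym (when-distrib-sumFin (i == w) (A i)))) (sumFin-delta w (sumFin ∘ A))

  tripleEq : Triple N → Fin N → Fin N → Fin N → Bool
  tripleEq (i , j , k) a b c = (i == a) ∧ (j == b) ∧ (k == c)

  sumFin-triangles-at : ∀ (h : Triple N → ℚ) a b c →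
                        sumFin (λ T → when (tripleEq (triAt G T) a b c) (h (triAt G T))) ≡
                        when (isTriangle G a b c) (h (a , b , c))
  sumFin-triangles-at h a b c = begin
    sumFin (λ T → when (tripleEq (triAt G T) a b c) (h (triAt G T)))
      ≡⟨ sumFin-triangles G (λ t → when (tripleEq t a b c) (h t)) ⟩
    sumFin (λ i → sumFin (λ j → sumFin (λ k → when (isTriangle G i j k) (when (tripleEq (i , j , k) a b c) (h (i , j , k))))))
      ≡⟨ sumFin-cong (λ i → sumFin-cong (λ j → sumFin-cong (λ k →
           when-comm (isTriangle G i j k) (tripleEq (i , j , k) a b c) (h (i , j , k))))) ⟩
    sumFin (λ i → sumFin (λ j → sumFin (λ k → when (tripleEq (i , j , k) a b c) (when (isTriangle G i j k) (h (i , j , k))))))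
      ≡⟨ sumFin-delta₃ a b c (λ i j k → when (isTriangle G i j k) (h (i , j , k))) ⟩
    when (isTriangle G a b c) (h (a , b , c)) ∎
    where open ≡-Reasoning

  t₁ t₂ t₃ : Fin (nT G) → Fin N
  t₁ T = proj₁ (triAt G T)
  t₂ T = proj₁ (proj₂ (triAt G T))
  t₃ T = proj₂ (proj₂ (triAt G T))

  isTriangle-listed : ∀ T → isTriangle G (t₁ T) (t₂ T) (t₃ T) ≡ true
  isTriangle-listed T = sumFin-indicator-true _ _ (sumFin-triangles-at (λ _ → 1ℚ) (t₁ T) (t₂ T) (t₃ T)) T
                          (∧-true⁺ (==-refl (t₁ T)) (∧-true⁺ (==-refl (t₂ T)) (==-refl (t₃ T))))

  onArcs-triangleSign : ∀ (X : Flow N) p q r → (p <F q) ≡ true → (q <F r) ≡ true → ∀ i j →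
                        when (isArc G i j) (triangleSign (p , q , r) (i , j) * X i j) ≡
                        when (pairEq (i , j) p q) (when (isArc G i j) (X i j))
                        + when (pairEq (i , j) q r) (when (isArc G i j) (X i j))
                        + - when (pairEq (i , j) p r) (when (isArc G i j) (X i j))
  onArcs-triangleSign X p q r p<q q<r i j with isArc G i j in arc
  ... | false = sym (cong₂ _+_ (cong₂ _+_ (when-zero (pairEq (i , j) p q)) (when-zero (pairEq (i , j) q r)))
                               (cong -_ (when-zero (pairEq (i , j) p r))))
  ... | true  = begin
    triangleSign (p , q , r) (i , j) * X i j
      ≡⟨ cong (_* X i j) (triangleSign-sorted p q r i j p<q q<r (proj₁ (∧-true⁻ arc))) ⟩
    (indicator pq + indicator qr + - indicator pr) * X i j
      ≡⟨ distrib (indicator pq) (indicator qr) (indicator pr) (X i j) ⟩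
    indicator pq * X i j + indicator qr * X i j + - (indicator pr * X i j)
      ≡⟨ cong₂ (λ s t → s + - t) (cong₂ _+_ (indicator-* pq (X i j)) (indicator-* qr (X i j))) (indicator-* pr (X i j)) ⟩
    when pq (X i j) + when qr (X i j) + - when pr (X i j) ∎
    where
    open ≡-Reasoning
    pq = pairEq (i , j) p q
    qr = pairEq (i , j) q r
    pr = pairEq (i , j) p r
    distrib : ∀ a b c x → (a + b + - c) * x ≡ a * x + b * x + - (c * x)
    distrib = solve 4 (λ a b c x → (a :+ b :+ :- c) :* x := a :* x :+ b :* x :+ :- (c :* x)) refl

  𝓒-fromFlow : ∀ X → IsAntisymmetric X → IsSupportedOn G X → ∀ T →
               apply (𝓒 G) (fromFlow X) T ≡ circulation X (t₁ T) (t₂ T) (t₃ T)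
  𝓒-fromFlow X X-anti X-supp T = begin
    sumFin (λ e → 𝓒 G T e * fromFlow X e)
      ≡⟨ sumFin-edges G (λ e → triangleSign (p , q , r) e * X (proj₁ e) (proj₂ e)) ⟩
    sumFin₂ (λ i j → when (isArc G i j) (triangleSign (p , q , r) (i , j) * X i j))
      ≡⟨ sumFin-cong (λ i → sumFin-cong (onArcs-triangleSign X p q r p<q q<r i)) ⟩
    sumFin₂ (λ i j → at p q i j + at q r i j + - at p r i j)
      ≡⟨ sumFin₂-sub (λ i j → at p q i j + at q r i j) (at p r) ⟩
    sumFin₂ (λ i j → at p q i j + at q r i j) + - sumFin₂ (at p r)
      ≡⟨ cong (_+ - sumFin₂ (at p r)) (sumFin₂-+ (at p q) (at q r)) ⟩
    sumFin₂ (at p q) + sumFin₂ (at q r) + - sumFin₂ (at p r)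
      ≡⟨ cong₂ (λ s t → s + - t) (cong₂ _+_ (sumFin-delta₂ p q A) (sumFin-delta₂ q r A)) (sumFin-delta₂ p r A) ⟩
    A p q + A q r + - A p r
      ≡⟨ cong₂ (λ s t → s + - t) (cong₂ _+_ (onArcs-forward X X-supp p q p<q) (onArcs-forward X X-supp q r q<r))
                                 (onArcs-forward X X-supp p r p<r) ⟩
    X p q + X q r + - X p r
      ≡⟨ cong (X p q + X q r +_) (X-anti r p) ⟨
    circulation X p q r ∎
    where
    open ≡-Reasoning
    p = t₁ T
    q = t₂ T
    r = t₃ T
    p<q : (p <F q) ≡ true
    p<q = proj₁ (∧-true⁻ (isTriangle-listed T))
    q<r : (q <F r) ≡ true
    q<r = proj₁ (∧-true⁻ (proj₂ (∧-true⁻ {p <F q} (isTriangle-listed T))))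
    p<r : (p <F r) ≡ true
    p<r = <F-trans {a = p} {q} {r} p<q q<r
    A = onArcs X
    at : Fin N → Fin N → Flow N
    at a b i j = when (pairEq (i , j) a b) (A i j)

  isTriangle⁺ : ∀ {p q r} → (p <F q) ≡ true → (q <F r) ≡ true →
                adj G p q ≡ true → adj G q r ≡ true → adj G p r ≡ true → isTriangle G p q r ≡ true
  isTriangle⁺ p<q q<r p~q q~r p~r = ∧-true⁺ p<q (∧-true⁺ q<r (∧-true⁺ p~q (∧-true⁺ q~r p~r)))

  isTriangle⇒adj : ∀ p q r → isTriangle G p q r ≡ true → adj G p q ≡ true × adj G q r ≡ true × adj G p r ≡ true
  isTriangle⇒adj p q r pqr with ∧-true⁻ {p <F q} pqr
  ... | _ , qr with ∧-true⁻ {q <F r} qr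
  ... | _ , adjs with ∧-true⁻ {adj G p q} adjs
  ... | p~q , rest = p~q , ∧-true⁻ {adj G q r} rest

  circulation-free-sorted : ∀ X → IsAntisymmetric X →
    (∀ p q r → isTriangle G p q r ≡ true → circulation X p q r ≡ 0ℚ) →
    ∀ i j k → adj G i j ≡ true → adj G j k ≡ true → adj G i k ≡ true → circulation X i j k ≡ 0ℚ
  circulation-free-sorted X X-anti sorted i j k i~j j~k i~k
    with <F-trichotomy i j | <F-trichotomy j k | <F-trichotomy i k
  ... | inj₂ (inj₂ i≡j) | _ | _ = contradiction i≡j (adj⇒≢ G i~j)
  ... | _ | inj₂ (inj₂ j≡k) | _ = contradiction j≡k (adj⇒≢ G j~k)
  ... | _ | _ | inj₂ (inj₂ i≡k) = contradiction i≡k (adj⇒≢ G i~k)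
  ... | inj₁ i<j | inj₁ j<k | _ = sorted i j k (isTriangle⁺ i<j j<k i~j j~k i~k)
  ... | inj₁ i<j | inj₂ (inj₁ k<j) | inj₁ i<k =
    circulation-rotate X k i j (circulation-swap X X-anti i k j (sorted i k j (isTriangle⁺ i<k k<j i~k (adj-flip G j~k) i~j)))
  ... | inj₁ i<j | inj₂ (inj₁ k<j) | inj₂ (inj₁ k<i) =
    circulation-rotate X k i j (sorted k i j (isTriangle⁺ k<i i<j (adj-flip G i~k) i~j (adj-flip G j~k)))
  ... | inj₂ (inj₁ j<i) | _ | inj₁ i<k =
    circulation-swap X X-anti j i k (sorted j i k (isTriangle⁺ j<i i<k (adj-flip G i~j) i~k j~k))
  ... | inj₂ (inj₁ j<i) | inj₁ j<k | inj₂ (inj₁ k<i) =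
    circulation-rotate X k i j (circulation-rotate X j k i (sorted j k i (isTriangle⁺ j<k k<i j~k (adj-flip G i~k) (adj-flip G i~j))))
  ... | inj₂ (inj₁ j<i) | inj₂ (inj₁ k<j) | inj₂ (inj₁ k<i) =
    circulation-rotate X k i j (circulation-rotate X j k i (circulation-swap X X-anti k j i (sorted k j i (isTriangle⁺ k<j j<i (adj-flip G j~k) (adj-flip G i~j) (adj-flip G i~k)))))

  toFlow-harmonic : ∀ x → InKer (𝓗 G) x → IsHarmonic G (toFlow x)
  toFlow-harmonic x x∈ker = record
    { antisym          = toFlow-antisym x
    ; supported        = toFlow-supported x
    ; divergence-free  = λ w → ℚ.neg-injective (trans (sym (𝓑ᵀ-fromFlow X (toFlow-antisym x) (toFlow-supported x) w))
                                                       (trans (apply-cong (transpose (𝓑 G)) (fromFlow-toFlow x) w) (𝓑ᵀx≡0 w)))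
    ; circulation-free = circulation-free-sorted X (toFlow-antisym x) sorted
    }
    where
    X = toFlow x
    𝓑ᵀx≡0 = proj₁ (Equivalence.to (InKer-gram-+ (transpose (𝓑 G)) (𝓒 G) x) x∈ker)
    𝓒x≡0  = proj₂ (Equivalence.to (InKer-gram-+ (transpose (𝓑 G)) (𝓒 G) x) x∈ker)
    listed : ∀ T → circulation X (t₁ T) (t₂ T) (t₃ T) ≡ 0ℚ
    listed T = trans (sym (𝓒-fromFlow X (toFlow-antisym x) (toFlow-supported x) T))
                     (trans (apply-cong (𝓒 G) (fromFlow-toFlow x) T) (𝓒x≡0 T))
    sorted : ∀ p q r → isTriangle G p q r ≡ true → circulation X p q r ≡ 0ℚ
    sorted p q r pqr = begin
      circulation X p q r
        ≡⟨ when-true (circulation X p q r) pqr ⟨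
      when (isTriangle G p q r) (circulation X p q r)
        ≡⟨ sumFin-triangles-at (λ (a , b , c) → circulation X a b c) p q r ⟨
      sumFin (λ T → when (tripleEq (triAt G T) p q r) (circulation X (t₁ T) (t₂ T) (t₃ T)))
        ≡⟨ sumFin-zero (λ T → trans (cong (when (tripleEq (triAt G T) p q r)) (listed T)) (when-zero _)) ⟩
      0ℚ ∎
      where open ≡-Reasoning

  fromFlow-kernel : ∀ X → IsHarmonic G X → InKer (𝓗 G) (fromFlow X)
  fromFlow-kernel X X-harmonic = Equivalence.from (InKer-gram-+ (transpose (𝓑 G)) (𝓒 G) (fromFlow X))
    ( (λ w → trans (𝓑ᵀ-fromFlow X antisym supported w) (cong -_ (divergence-free w)))
    , (λ T → let (p~q , q~r , p~r) = isTriangle⇒adj (t₁ T) (t₂ T) (t₃ T) (isTriangle-listed T) in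
             trans (𝓒-fromFlow X antisym supported T) (circulation-free (t₁ T) (t₂ T) (t₃ T) p~q q~r p~r)))
    where open IsHarmonic X-harmonic

IsFlowLinear-cong : ∀ {N N′} {F : Flow N → Flow N′} → IsFlowLinear F →
                    ∀ X Y → (∀ a b → X a b ≡ Y a b) → ∀ a b → F X a b ≡ F Y a b
IsFlowLinear-cong {F = F} F-linear X Y X≗Y a b = begin
  F X a b             ≡⟨ F-linear {1} (λ _ → 1ℚ) (λ _ → Y) X (λ a b → trans (X≗Y a b) (sym (one· (Y a b)))) a b ⟩
  1ℚ * F Y a b + 0ℚ   ≡⟨ one· (F Y a b) ⟩
  F Y a b             ∎
  where
  open ≡-Reasoning
  one· : ∀ z → 1ℚ * z + 0ℚ ≡ z
  one· z = trans (ℚ.+-identityʳ (1ℚ * z)) (ℚ.*-identityˡ z)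

record HarmonicIso {N N′} (G : Graph N) (G′ : Graph N′) : Set where
  field
    to            : Flow N → Flow N′
    from          : Flow N′ → Flow N
    to-linear     : IsFlowLinear to
    from-linear   : IsFlowLinear from
    to-harmonic   : ∀ X → IsHarmonic G X → IsHarmonic G′ (to X)
    from-harmonic : ∀ Y → IsHarmonic G′ Y → IsHarmonic G (from Y)
    from∘to       : ∀ X → IsHarmonic G X → ∀ a b → from (to X) a b ≡ X a b
    to∘from       : ∀ Y → IsHarmonic G′ Y → ∀ a b → to (from Y) a b ≡ Y a b

HarmonicIso-sym : ∀ {N N′} {G : Graph N} {G′ : Graph N′} → HarmonicIso G G′ → HarmonicIso G′ G
HarmonicIso-sym iso = record
  { to = from ; from = to ; to-linear = from-linear ; from-linear = to-linear
  ; to-harmonic = from-harmonic ; from-harmonic = to-harmonic ; from∘to = to∘from ; to∘from = from∘to }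
  where open HarmonicIso iso

module _ {N N′} {G : Graph N} {G′ : Graph N′} (iso : HarmonicIso G G′) where
  open HarmonicIso iso
  private
    module E  = EdgeFlows G
    module E′ = EdgeFlows G′

  onEdges : (Fin (nE G) → ℚ) → Fin (nE G′) → ℚ
  onEdges x = E′.fromFlow (to (E.toFlow x))

  onEdges-linear : IsLinear onEdges
  onEdges-linear c ws z z≡Σ e′ = to-linear c (E.toFlow ∘ ws) (E.toFlow z) (E.toFlow-linear c ws z z≡Σ) (E′.src e′) (E′.tgt e′)

  onEdges-kernel : ∀ x → InKer (𝓗 G) x → InKer (𝓗 G′) (onEdges x)
  onEdges-kernel x x∈ker = E′.fromFlow-kernel _ (to-harmonic _ (E.toFlow-harmonic x x∈ker))

  onEdges-roundtrip : ∀ x → InKer (𝓗 G) x → ∀ e → E.fromFlow (from (E′.toFlow (onEdges x))) e ≡ x e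
  onEdges-roundtrip x x∈ker e = begin
    from (E′.toFlow (E′.fromFlow Y)) (E.src e) (E.tgt e) ≡⟨ IsFlowLinear-cong from-linear _ _ toFlow-fromFlow (E.src e) (E.tgt e) ⟩
    from Y (E.src e) (E.tgt e)                           ≡⟨ from∘to X X-harmonic (E.src e) (E.tgt e) ⟩
    X (E.src e) (E.tgt e)                                ≡⟨ E.fromFlow-toFlow x e ⟩
    x e                                                  ∎
    where
    open ≡-Reasoning
    X = E.toFlow x
    X-harmonic = E.toFlow-harmonic x x∈ker
    Y = to X
    Y-harmonic = to-harmonic X X-harmonic
    toFlow-fromFlow = E′.toFlow-fromFlow Y (IsHarmonic.antisym Y-harmonic) (IsHarmonic.supported Y-harmonic)

HarmonicIso⇒KernelIso : ∀ {N N′} {G : Graph N} {G′ : Graph N′} → HarmonicIso G G′ → KernelIso (𝓗 G) (𝓗 G′)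
HarmonicIso⇒KernelIso iso = record
  { to          = onEdges iso
  ; from        = onEdges (HarmonicIso-sym iso)
  ; to-linear   = onEdges-linear iso
  ; from-linear = onEdges-linear (HarmonicIso-sym iso)
  ; to-kernel   = onEdges-kernel iso
  ; from-kernel = onEdges-kernel (HarmonicIso-sym iso)
  ; from∘to     = onEdges-roundtrip iso
  ; to∘from     = onEdges-roundtrip (HarmonicIso-sym iso)
  }

-- Connectivity and the two sides of a cut edge

anyFin-intro : ∀ {n} (f : Fin n → Bool) i → f i ≡ true → anyFin f ≡ true
anyFin-intro f zero    fi = ∨-trueˡ _ fi
anyFin-intro f (suc i) fi = ∨-trueʳ (f zero) (anyFin-intro (f ∘ suc) i fi)

anyFin-elim : ∀ {n} (f : Fin n → Bool) → anyFin f ≡ true → ∃ λ i → f i ≡ true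
anyFin-elim {suc n} f any-f with f zero in f0
... | true  = zero , f0
... | false = let (i , fi) = anyFin-elim (f ∘ suc) any-f in suc i , fi

anyFin-false : ∀ {n} (f : Fin n → Bool) → anyFin f ≡ false → ∀ i → f i ≡ false
anyFin-false f none i with f i in fi
... | false = refl
... | true  = contradiction (trans (sym (anyFin-intro f i fi)) none) true≢false

anyFin-cong : ∀ {n} {f g : Fin n → Bool} → (∀ i → f i ≡ g i) → anyFin f ≡ anyFin g
anyFin-cong {zero}  f≗g = refl
anyFin-cong {suc n} f≗g = cong₂ _∨_ (f≗g zero) (anyFin-cong (f≗g ∘ suc))

countFin-cong : ∀ {n} {f g : Fin n → Bool} → (∀ i → f i ≡ g i) → countFin f ≡ countFin g
countFin-cong {zero}  f≗g = refl
countFin-cong {suc n} f≗g = cong₂ ℕ._+_ (cong (λ b → if b then 1 else 0) (f≗g zero)) (countFin-cong (f≗g ∘ suc))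

countFin-≤ : ∀ {n} (f : Fin n → Bool) → countFin f ℕ.≤ n
countFin-≤ {zero}  f = ℕ.z≤n
countFin-≤ {suc n} f with f zero
... | true  = ℕ.s≤s (countFin-≤ (f ∘ suc))
... | false = ℕ.m≤n⇒m≤1+n (countFin-≤ (f ∘ suc))

countFin-pos : ∀ {n} (f : Fin n → Bool) i → f i ≡ true → 1 ℕ.≤ countFin f
countFin-pos f zero    f0 rewrite f0 = ℕ.s≤s ℕ.z≤n
countFin-pos f (suc i) fi with f zero
... | true  = ℕ.s≤s ℕ.z≤n
... | false = countFin-pos (f ∘ suc) i fi

countFin-mono : ∀ {n} (f g : Fin n → Bool) → (∀ i → f i ≡ true → g i ≡ true) → countFin f ℕ.≤ countFin g
countFin-mono {zero}  f g f⊆g = ℕ.z≤n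
countFin-mono {suc n} f g f⊆g with f zero in f0 | g zero in g0
... | true  | true  = ℕ.s≤s (countFin-mono (f ∘ suc) (g ∘ suc) (f⊆g ∘ suc))
... | true  | false = contradiction (trans (sym (f⊆g zero f0)) g0) true≢false
... | false | true  = ℕ.m≤n⇒m≤1+n (countFin-mono (f ∘ suc) (g ∘ suc) (f⊆g ∘ suc))
... | false | false = countFin-mono (f ∘ suc) (g ∘ suc) (f⊆g ∘ suc)

countFin-strict : ∀ {n} (f g : Fin n → Bool) → (∀ i → f i ≡ true → g i ≡ true) →
                  ∀ i → f i ≡ false → g i ≡ true → countFin f ℕ.< countFin g
countFin-strict f g f⊆g zero f0 g0 rewrite f0 | g0 = ℕ.s≤s (countFin-mono (f ∘ suc) (g ∘ suc) (f⊆g ∘ suc))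
countFin-strict f g f⊆g (suc i) fi gi with f zero in f0 | g zero in g0
... | true  | true  = ℕ.s≤s (countFin-strict (f ∘ suc) (g ∘ suc) (f⊆g ∘ suc) i fi gi)
... | true  | false = contradiction (trans (sym (f⊆g zero f0)) g0) true≢false
... | false | true  = ℕ.m≤n⇒m≤1+n (countFin-strict (f ∘ suc) (g ∘ suc) (f⊆g ∘ suc) i fi gi)
... | false | false = countFin-strict (f ∘ suc) (g ∘ suc) (f⊆g ∘ suc) i fi gi

module Reachability {n} (H : Graph n) where

  private
    R = reachWithin H

  reach-step : ∀ k a b → R k a b ≡ true → R (suc k) a b ≡ true
  reach-step k a b a⇝b = ∨-trueˡ _ a⇝b

  reach-extend : ∀ k a l b → R k a l ≡ true → adj H l b ≡ true → R (suc k) a b ≡ true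
  reach-extend k a l b a⇝l l~b =
    ∨-trueʳ (R k a b) (anyFin-intro (λ l → R k a l ∧ adj H l b) l (∧-true⁺ a⇝l l~b))

  reach-last-step : ∀ k a b → R (suc k) a b ≡ true →
                    R k a b ≡ true ⊎ ∃ λ l → R k a l ≡ true × adj H l b ≡ true
  reach-last-step k a b a⇝b with R k a b
  ... | true  = inj₁ refl
  ... | false = let (l , a⇝l~b) = anyFin-elim (λ l → R k a l ∧ adj H l b) a⇝b in inj₂ (l , ∧-true⁻ a⇝l~b)

  reach-refl : ∀ k a → R k a a ≡ true
  reach-refl zero    a = ==-refl a
  reach-refl (suc k) a = reach-step k a a (reach-refl k a)

  Saturated : Fin n → ℕ → Set
  Saturated a k = ∀ t → R (suc k) a t ≡ true → R k a t ≡ true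

  saturated-step : ∀ a k → Saturated a k → Saturated a (suc k)
  saturated-step a k sat t a⇝t with reach-last-step (suc k) a t a⇝t
  ... | inj₁ a⇝t′ = a⇝t′
  ... | inj₂ (l , a⇝l , l~t) = reach-extend k a l t (sat l a⇝l) l~t

  -- Until the reachable set saturates it gains a vertex at every step.
  saturated-or-growing : ∀ a k → Saturated a k ⊎ suc k ℕ.≤ countFin (R k a)
  saturated-or-growing a zero = inj₂ (countFin-pos (R zero a) a (==-refl a))
  saturated-or-growing a (suc k) with saturated-or-growing a k
  ... | inj₁ sat = inj₁ (saturated-step a k sat)
  ... | inj₂ growing with anyFin (λ t → R (suc k) a t ∧ not (R k a t)) in new
  ...   | false = inj₁ (saturated-step a k (λ t a⇝t → Bool.¬-not λ short →
                    true≢false (trans (sym (∧-true⁺ a⇝t (cong not short)))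
                                      (anyFin-false (λ t → R (suc k) a t ∧ not (R k a t)) new t))))
  ...   | true  = let (t , t-new) = anyFin-elim (λ t → R (suc k) a t ∧ not (R k a t)) new
                      (a⇝t , fresh) = ∧-true⁻ t-new in
                  inj₂ (ℕ.≤-trans (ℕ.s≤s growing)
                         (countFin-strict (R k a) (R (suc k) a) (reach-step k a) t (not-true⁻ fresh) a⇝t))

  reach-saturated : ∀ a t → R (suc n) a t ≡ true → connected H a t ≡ true
  reach-saturated a with saturated-or-growing a n
  ... | inj₁ sat     = sat
  ... | inj₂ growing = ⊥-elim (ℕ.<-irrefl refl (ℕ.≤-trans growing (countFin-≤ (R n a))))

  connected-refl : ∀ a → connected H a a ≡ true
  connected-refl = reach-refl n

  connected-extend : ∀ a b c → connected H a b ≡ true → adj H b c ≡ true → connected H a c ≡ true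
  connected-extend a b c a⇝b b~c = reach-saturated a c (reach-extend n a b c a⇝b b~c)

  connected-reach : ∀ k a b c → connected H a b ≡ true → R k b c ≡ true → connected H a c ≡ true
  connected-reach zero    a b c a⇝b b≡c = subst (λ x → connected H a x ≡ true) (==⇒≡ b≡c) a⇝b
  connected-reach (suc k) a b c a⇝b b⇝c with reach-last-step k b c b⇝c
  ... | inj₁ b⇝c′ = connected-reach k a b c a⇝b b⇝c′
  ... | inj₂ (l , b⇝l , l~c) = connected-extend a l c (connected-reach k a b l a⇝b b⇝l) l~c

  connected-trans : ∀ a b c → connected H a b ≡ true → connected H b c ≡ true → connected H a c ≡ true
  connected-trans a b c = connected-reach n a b c

  reach⇒connected-sym : ∀ k a b → R k a b ≡ true → connected H b a ≡ true
  reach⇒connected-sym zero    a b a≡b = subst (λ x → connected H x a ≡ true) (==⇒≡ a≡b) (connected-refl a)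
  reach⇒connected-sym (suc k) a b a⇝b with reach-last-step k a b a⇝b
  ... | inj₁ a⇝b′ = reach⇒connected-sym k a b a⇝b′
  ... | inj₂ (l , a⇝l , l~b) =
    connected-trans b l a (connected-extend b b l (connected-refl b) (adj-flip H l~b)) (reach⇒connected-sym k a l a⇝l)

  connected-sym : ∀ a b → connected H a b ≡ true → connected H b a ≡ true
  connected-sym = reach⇒connected-sym n

reach-subgraph : ∀ {n} (H₁ H₂ : Graph n) → (∀ a b → adj H₁ a b ≡ true → adj H₂ a b ≡ true) →
                 ∀ k a b → reachWithin H₁ k a b ≡ true → reachWithin H₂ k a b ≡ true
reach-subgraph H₁ H₂ H₁⊆H₂ zero    a b a≡b = a≡b
reach-subgraph H₁ H₂ H₁⊆H₂ (suc k) a b a⇝b with Reachability.reach-last-step H₁ k a b a⇝b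
... | inj₁ a⇝b′ = Reachability.reach-step H₂ k a b (reach-subgraph H₁ H₂ H₁⊆H₂ k a b a⇝b′)
... | inj₂ (l , a⇝l , l~b) = Reachability.reach-extend H₂ k a l b (reach-subgraph H₁ H₂ H₁⊆H₂ k a l a⇝l) (H₁⊆H₂ l b l~b)

isUV⇒≡ : ∀ {n} (u v s t : Fin n) → isUV u v s t ≡ true → (s ≡ u × t ≡ v) ⊎ (s ≡ v × t ≡ u)
isUV⇒≡ u v s t st≡uv with ∨-true⁻ {(s == u) ∧ (t == v)} st≡uv
... | inj₁ st≡uv′ = inj₁ (pairEq⇒≡ s t u v st≡uv′)
... | inj₂ st≡vu  = inj₂ (pairEq⇒≡ s t v u st≡vu)

module CutEdge {n} (G : Graph n) (u v : Fin n) (cut : IsCutEdge G u v) where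

  G∖e : Graph n
  G∖e = deleteEdge G u v

  private
    module R∖e = Reachability G∖e

  side : Fin n → Bool
  side = connected G∖e u

  side-u : side u ≡ true
  side-u = R∖e.connected-refl u

  side-closed : ∀ s t → side s ≡ true → adj G∖e s t ≡ true → side t ≡ true
  side-closed s t = R∖e.connected-extend u s t

  connected-without-cut-edge : side v ≡ true → ∀ a b → connected G a b ≡ connected G∖e a b
  connected-without-cut-edge v-side a b =
    Bool.⇔→≡ {z = true} (mk⇔ (walk n b) (reach-subgraph G∖e G (λ s t → proj₁ ∘ ∧-true⁻) n a b))
    where
    walk : ∀ k b → reachWithin G k a b ≡ true → connected G∖e a b ≡ true
    walk zero    b a≡b = subst (λ x → connected G∖e a x ≡ true) (==⇒≡ a≡b) (R∖e.connected-refl a)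
    walk (suc k) b a⇝b with Reachability.reach-last-step G k a b a⇝b
    ... | inj₁ a⇝b′ = walk k b a⇝b′
    ... | inj₂ (l , a⇝l , l~b) with isUV u v l b in uv
    ...   | false = R∖e.connected-extend a l b (walk k l a⇝l) (∧-true⁺ l~b (cong not uv))
    ...   | true with isUV⇒≡ u v l b uv
    ...     | inj₁ (refl , refl) = R∖e.connected-trans a u v (walk k u a⇝l) v-side
    ...     | inj₂ (refl , refl) = R∖e.connected-trans a v u (walk k v a⇝l) (R∖e.connected-sym u v v-side)

  side-v : side v ≡ false
  side-v with side v in v-side
  ... | false = refl
  ... | true  = ⊥-elim (ℕ.<-irrefl same-components (proj₂ cut))
    where
    same-components : components G ≡ components G∖e
    same-components = countFin-cong (λ i → cong not (anyFin-cong (λ j →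
      cong ((toℕ j ℕ.<ᵇ toℕ i) ∧_) (connected-without-cut-edge v-side j i))))

  edge∖e⁻ : ∀ {s t} → adj G∖e s t ≡ true → adj G s t ≡ true × isUV u v s t ≡ false
  edge∖e⁻ {s} {t} st = let (s~t , ¬uv) = ∧-true⁻ {adj G s t} st in s~t , not-true⁻ ¬uv

  edge∖e⁺ : ∀ {s t} → adj G s t ≡ true → isUV u v s t ≡ false → adj G∖e s t ≡ true
  edge∖e⁺ s~t ¬uv = ∧-true⁺ s~t (cong not ¬uv)

  isUV-uv : isUV u v u v ≡ true
  isUV-uv = ∨-trueˡ _ (∧-true⁺ (==-refl u) (==-refl v))

  isUV-vu : isUV u v v u ≡ true
  isUV-vu = ∨-trueʳ ((v == u) ∧ (u == v)) (∧-true⁺ (==-refl v) (==-refl u))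

  isUV-false : ∀ s t → (s ≡ u → t ≡ v → ⊥) → (s ≡ v → t ≡ u → ⊥) → isUV u v s t ≡ false
  isUV-false s t ≢uv ≢vu = cong₂ _∨_ (pairEq-false s t u v ≢uv) (pairEq-false s t v u ≢vu)

  neighbour-of-u : ∀ t → adj G u t ≡ true → t ≢ v → side t ≡ true
  neighbour-of-u t u~t t≢v = side-closed u t side-u (edge∖e⁺ u~t (isUV-false u t (λ _ → t≢v) (λ u≡v _ → adj⇒≢ G (proj₁ cut) u≡v)))

  neighbour-of-v : ∀ t → adj G v t ≡ true → t ≢ u → side t ≡ false
  neighbour-of-v t v~t t≢u with side t in t-side
  ... | false = refl
  ... | true  = contradiction (trans (sym (side-closed t v t-side (edge∖e⁺ (adj-flip G v~t) ¬uv))) side-v) true≢false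
    where
    ¬uv : isUV u v t v ≡ false
    ¬uv = isUV-false t v (λ t≡u _ → t≢u t≡u) (λ t≡v _ → adj⇒≢ G v~t (sym t≡v))

  no-common-neighbour : ∀ t → adj G u t ≡ true → adj G v t ≡ true → ⊥
  no-common-neighbour t u~t v~t =
    true≢false (trans (sym (neighbour-of-u t u~t (adj⇒≢ G v~t ∘ sym))) (neighbour-of-v t v~t (adj⇒≢ G u~t ∘ sym)))

  endpoint-neighbour-side : ∀ w t → w ≡ u ⊎ w ≡ v → adj G∖e w t ≡ true → side t ≡ side w
  endpoint-neighbour-side w t (inj₁ refl) w~t =
    let (u~t , ¬uv) = edge∖e⁻ w~t in
    trans (neighbour-of-u t u~t (λ { refl → true≢false (trans (sym isUV-uv) ¬uv) })) (sym side-u)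
  endpoint-neighbour-side w t (inj₂ refl) w~t =
    let (v~t , ¬vu) = edge∖e⁻ w~t in
    trans (neighbour-of-v t v~t (λ { refl → true≢false (trans (sym isUV-vu) ¬vu) })) (sym side-v)

  harmonic-cut-edge : ∀ X → IsHarmonic G X → X u v ≡ 0ℚ
  harmonic-cut-edge X X-harmonic = begin
    X u v      ≡⟨ cong (λ b → when (not b) (X u v)) side-v ⟨
    when (not (side v)) (X u v)
               ≡⟨ cong (λ b → when b (when (not (side v)) (X u v))) side-u ⟨
    when (side u) (when (not (side v)) (X u v))
               ≡⟨ sumFin-single₂ u v (λ s t → when (side s) (when (not (side t)) (X s t))) only-uv ⟨
    flux X side ≡⟨ flux-zero X antisym divergence-free side ⟩
    0ℚ         ∎
    where
    open ≡-Reasoning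
    open IsHarmonic X-harmonic
    only-uv : ∀ s t → (s ≡ u → t ≡ v → ⊥) → when (side s) (when (not (side t)) (X s t)) ≡ 0ℚ
    only-uv s t ≢uv with side s in s-side | side t in t-side
    ... | false | _    = refl
    ... | true  | true = refl
    ... | true  | false with adj G s t in s~t
    ...   | false = supported s t s~t
    ...   | true with isUV u v s t in uv
    ...     | false = contradiction (trans (sym (side-closed s t s-side (∧-true⁺ s~t (cong not uv)))) t-side) true≢false
    ...     | true with isUV⇒≡ u v s t uv
    ...       | inj₁ (s≡u , t≡v) = ⊥-elim (≢uv s≡u t≡v)
    ...       | inj₂ (refl , refl) = contradiction (trans (sym s-side) side-v) true≢false

-- Contracting a cut edge

module Merge {n} (u v : Fin (suc n)) (v≢u : v ≢ u) where

  merge : Fin (suc n) → Fin n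
  merge = collapse u v v≢u

  split : Fin n → Fin (suc n)
  split = punchIn v

  u≢v : u ≢ v
  u≢v = v≢u ∘ sym

  merge-≢v : ∀ x (x≢v : x ≢ v) → merge x ≡ punchOut (x≢v ∘ sym)
  merge-≢v x x≢v with x ≟ v
  ... | yes x≡v = contradiction x≡v x≢v
  ... | no  _   = Fin.punchOut-cong v refl

  merge-v : merge v ≡ punchOut v≢u
  merge-v with v ≟ v
  ... | yes _   = refl
  ... | no  v≢v = contradiction refl v≢v

  merge-v≡merge-u : merge v ≡ merge u
  merge-v≡merge-u = trans merge-v (sym (merge-≢v u u≢v))

  merge-split : ∀ a → merge (split a) ≡ a
  merge-split a = trans (merge-≢v (split a) (Fin.punchInᵢ≢i v a)) (trans (Fin.punchOut-cong v refl) (Fin.punchOut-punchIn v))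

  split-merge : ∀ x → x ≢ v → split (merge x) ≡ x
  split-merge x x≢v = trans (cong split (merge-≢v x x≢v)) (Fin.punchIn-punchOut (x≢v ∘ sym))

  merge-injective : ∀ x y → merge x ≡ merge y → x ≡ y ⊎ (x ≡ u × y ≡ v) ⊎ (x ≡ v × y ≡ u)
  merge-injective x y mx≡my with toSum (x ≟ v) | toSum (y ≟ v)
  ... | inj₁ x≡v | inj₁ y≡v = inj₁ (trans x≡v (sym y≡v))
  ... | inj₁ x≡v | inj₂ y≢v = inj₂ (inj₂ (x≡v , sym (Fin.punchOut-injective v≢u (y≢v ∘ sym)
                              (trans (sym merge-v) (trans (cong merge (sym x≡v)) (trans mx≡my (merge-≢v y y≢v)))))))
  ... | inj₂ x≢v | inj₁ y≡v = inj₂ (inj₁ (Fin.punchOut-injective (x≢v ∘ sym) v≢u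
                              (trans (sym (merge-≢v x x≢v)) (trans mx≡my (trans (cong merge y≡v) merge-v))) , y≡v))
  ... | inj₂ x≢v | inj₂ y≢v = inj₁ (Fin.punchOut-injective (x≢v ∘ sym) (y≢v ∘ sym)
                              (trans (sym (merge-≢v x x≢v)) (trans mx≡my (merge-≢v y y≢v))))

  merge≢merge-u⇒ : ∀ x → merge x ≢ merge u → x ≢ u × x ≢ v
  merge≢merge-u⇒ x mx≢mu = (λ x≡u → mx≢mu (cong merge x≡u)) , (λ x≡v → mx≢mu (trans (cong merge x≡v) merge-v≡merge-u))

  merge≢merge-u⇐ : ∀ x → x ≢ u → x ≢ v → merge x ≢ merge u
  merge≢merge-u⇐ x x≢u x≢v mx≡mu with merge-injective x u mx≡mu
  ... | inj₁ x≡u              = x≢u x≡u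
  ... | inj₂ (inj₁ (x≡u , _)) = x≢u x≡u
  ... | inj₂ (inj₂ (x≡v , _)) = x≢v x≡v

  merge-injective-off-u : ∀ x y → merge x ≡ merge y → merge x ≢ merge u → x ≡ y
  merge-injective-off-u x y mx≡my mx≢mu with merge-injective x y mx≡my
  ... | inj₁ x≡y              = x≡y
  ... | inj₂ (inj₁ (x≡u , _)) = contradiction x≡u (proj₁ (merge≢merge-u⇒ x mx≢mu))
  ... | inj₂ (inj₂ (x≡v , _)) = contradiction x≡v (proj₂ (merge≢merge-u⇒ x mx≢mu))

  merge-fibre-u : ∀ x → merge x ≡ merge u → x ≡ u ⊎ x ≡ v
  merge-fibre-u x mx≡mu with merge-injective x u mx≡mu
  ... | inj₁ x≡u              = inj₁ x≡u
  ... | inj₂ (inj₁ (x≡u , _)) = inj₁ x≡u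
  ... | inj₂ (inj₂ (x≡v , _)) = inj₂ x≡v

module Contraction {n} (G : Graph (suc n)) (u v : Fin (suc n)) (v≢u : v ≢ u) (cut : IsCutEdge G u v) where
  open Merge u v v≢u
  open CutEdge G u v cut

  G/e : Graph n
  G/e = contract G u v v≢u

  isUV⇒merge≡ : ∀ s t → isUV u v s t ≡ true → merge s ≡ merge t
  isUV⇒merge≡ s t st≡uv with isUV⇒≡ u v s t st≡uv
  ... | inj₁ (refl , refl) = sym merge-v≡merge-u
  ... | inj₂ (refl , refl) = merge-v≡merge-u

  edge∖e-merge-≢ : ∀ s t → adj G∖e s t ≡ true → merge s ≢ merge t
  edge∖e-merge-≢ s t st ms≡mt with edge∖e⁻ {s} {t} st | merge-injective s t ms≡mt
  ... | s~t , _ | inj₁ s≡t                 = adj⇒≢ G s~t s≡t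
  ... | _ , ¬uv | inj₂ (inj₁ (refl , refl)) = true≢false (trans (sym isUV-uv) ¬uv)
  ... | _ , ¬uv | inj₂ (inj₂ (refl , refl)) = true≢false (trans (sym isUV-vu) ¬uv)

  -- Two edges of G ∖ e with the same image would give u and v a common neighbour.
  merge-edge-injective : ∀ s t x y → adj G∖e s t ≡ true → adj G∖e x y ≡ true →
                         merge s ≡ merge x → merge t ≡ merge y → s ≡ x × t ≡ y
  merge-edge-injective s t x y st xy ms≡mx mt≡my
    with edge∖e⁻ {s} {t} st | edge∖e⁻ {x} {y} xy | merge-injective s x ms≡mx | merge-injective t y mt≡my
  ... | _ | _ | inj₁ refl | inj₁ refl = refl , refl
  ... | s~t , _ | x~y , _ | inj₁ refl | inj₂ (inj₁ (refl , refl)) = ⊥-elim (no-common-neighbour s (adj-flip G s~t) (adj-flip G x~y))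
  ... | s~t , _ | x~y , _ | inj₁ refl | inj₂ (inj₂ (refl , refl)) = ⊥-elim (no-common-neighbour s (adj-flip G x~y) (adj-flip G s~t))
  ... | s~t , _ | x~y , _ | inj₂ (inj₁ (refl , refl)) | inj₁ refl = ⊥-elim (no-common-neighbour t s~t x~y)
  ... | s~t , _ | x~y , _ | inj₂ (inj₂ (refl , refl)) | inj₁ refl = ⊥-elim (no-common-neighbour t x~y s~t)
  ... | s~t , _ | _ | inj₂ (inj₁ (refl , refl)) | inj₂ (inj₁ (refl , refl)) = ⊥-elim (adj⇒≢ G s~t refl)
  ... | s~t , _ | _ | inj₂ (inj₂ (refl , refl)) | inj₂ (inj₂ (refl , refl)) = ⊥-elim (adj⇒≢ G s~t refl)
  ... | _ , ¬uv | _ | inj₂ (inj₁ (refl , refl)) | inj₂ (inj₂ (refl , refl)) = ⊥-elim (true≢false (trans (sym isUV-uv) ¬uv))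
  ... | _ , ¬vu | _ | inj₂ (inj₂ (refl , refl)) | inj₂ (inj₁ (refl , refl)) = ⊥-elim (true≢false (trans (sym isUV-vu) ¬vu))

  contrRel⁻ : ∀ a b → contrRel G u v v≢u a b ≡ true → ∃ λ x → ∃ λ y → merge x ≡ a × merge y ≡ b × adj G x y ≡ true
  contrRel⁻ a b rel =
    let (x , x-row) = anyFin-elim (λ x → anyFin (λ y → (merge x == a) ∧ (merge y == b) ∧ adj G x y)) rel
        (y , xy)    = anyFin-elim (λ y → (merge x == a) ∧ (merge y == b) ∧ adj G x y) x-row
        (mx≡a , rest) = ∧-true⁻ {merge x == a} xy
        (my≡b , x~y)  = ∧-true⁻ {merge y == b} rest
    in x , y , ==⇒≡ mx≡a , ==⇒≡ my≡b , x~y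

  contrAdj-≢ : ∀ a b → a ≢ b → adj G/e a b ≡ (contrRel G u v v≢u a b ∨ contrRel G u v v≢u b a)
  contrAdj-≢ a b a≢b with a ≟ b
  ... | yes a≡b = contradiction a≡b a≢b
  ... | no  _   = refl

  contract-edge : ∀ s t → adj G∖e s t ≡ true → adj G/e (merge s) (merge t) ≡ true
  contract-edge s t st = trans (contrAdj-≢ (merge s) (merge t) (edge∖e-merge-≢ s t st)) (∨-trueˡ _ merged)
    where
    merged : contrRel G u v v≢u (merge s) (merge t) ≡ true
    merged = anyFin-intro (λ x → anyFin (λ y → (merge x == merge s) ∧ (merge y == merge t) ∧ adj G x y)) s
               (anyFin-intro (λ y → (merge s == merge s) ∧ (merge y == merge t) ∧ adj G s y) t
                 (∧-true⁺ (==-refl (merge s)) (∧-true⁺ (==-refl (merge t)) (proj₁ (edge∖e⁻ st)))))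

  merge-≢⇒¬uv : ∀ x y → merge x ≢ merge y → isUV u v x y ≡ false
  merge-≢⇒¬uv x y mx≢my with isUV u v x y in uv
  ... | false = refl
  ... | true  = contradiction (isUV⇒merge≡ x y uv) mx≢my

  contract-edge⁻ : ∀ a b → adj G/e a b ≡ true →
                   ∃ λ s → ∃ λ t → adj G∖e s t ≡ true × merge s ≡ a × merge t ≡ b
  contract-edge⁻ a b ab with ∨-true⁻ {contrRel G u v v≢u a b} (trans (sym (contrAdj-≢ a b (adj⇒≢ G/e ab))) ab)
  ... | inj₁ rel = let (x , y , mx≡a , my≡b , x~y) = contrRel⁻ a b rel in
                   x , y , edge∖e⁺ x~y (merge-≢⇒¬uv x y (distinct x y mx≡a my≡b)) , mx≡a , my≡b
    where
    distinct : ∀ x y → merge x ≡ a → merge y ≡ b → merge x ≢ merge y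
    distinct x y refl refl = adj⇒≢ G/e ab
  ... | inj₂ rel = let (y , x , my≡b , mx≡a , y~x) = contrRel⁻ b a rel in
                   x , y , edge∖e⁺ (adj-flip G y~x) (merge-≢⇒¬uv x y (distinct x y mx≡a my≡b)) , mx≡a , my≡b
    where
    distinct : ∀ x y → merge x ≡ a → merge y ≡ b → merge x ≢ merge y
    distinct x y refl refl = adj⇒≢ G/e ab

  push : Flow (suc n) → Flow n
  push X a b = sumFin₂ (λ s t → when ((merge s == a) ∧ (merge t == b)) (X s t))

  pull : Flow n → Flow (suc n)
  pull Y s t = when (adj G∖e s t) (Y (merge s) (merge t))

  push-edge : ∀ X → IsSupportedOn G X → ∀ s t → adj G∖e s t ≡ true → push X (merge s) (merge t) ≡ X s t
  push-edge X X-supp s t st =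
    trans (sumFin-single₂ s t (λ s′ t′ → when ((merge s′ == merge s) ∧ (merge t′ == merge t)) (X s′ t′)) others)
          (when-true (X s t) (∧-true⁺ (==-refl (merge s)) (==-refl (merge t))))
    where
    others : ∀ s′ t′ → (s′ ≡ s → t′ ≡ t → ⊥) → when ((merge s′ == merge s) ∧ (merge t′ == merge t)) (X s′ t′) ≡ 0ℚ
    others s′ t′ ≢st with (merge s′ == merge s) ∧ (merge t′ == merge t) in same
    ... | false = refl
    ... | true with pairEq⇒≡ (merge s′) (merge t′) (merge s) (merge t) same | adj G s′ t′ in s′~t′ | isUV u v s′ t′ in uv
    ...   | _ , _         | false | _     = X-supp s′ t′ s′~t′
    ...   | ms′≡ , mt′≡   | true  | true  = contradiction (trans (sym ms′≡) (trans (isUV⇒merge≡ s′ t′ uv) mt′≡))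
                                                          (edge∖e-merge-≢ s t st)
    ...   | ms′≡ , mt′≡   | true  | false =
      let (s′≡s , t′≡t) = merge-edge-injective s′ t′ s t (edge∖e⁺ s′~t′ uv) st ms′≡ mt′≡ in ⊥-elim (≢st s′≡s t′≡t)

  push-edge′ : ∀ X → IsSupportedOn G X → ∀ s t {a b} → adj G∖e s t ≡ true → merge s ≡ a → merge t ≡ b → push X a b ≡ X s t
  push-edge′ X X-supp s t st refl refl = push-edge X X-supp s t st

  push-antisym : ∀ X → IsAntisymmetric X → IsAntisymmetric (push X)
  push-antisym X X-anti a b = begin
    sumFin₂ (λ s t → when ((merge s == a) ∧ (merge t == b)) (X s t))
      ≡⟨ sumFin-cong (λ s → sumFin-cong (λ t → flip s t)) ⟩
    sumFin₂ (λ s t → - when ((merge t == b) ∧ (merge s == a)) (X t s))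
      ≡⟨ sumFin₂-neg (λ s t → when ((merge t == b) ∧ (merge s == a)) (X t s)) ⟩
    - sumFin₂ (λ s t → when ((merge t == b) ∧ (merge s == a)) (X t s))
      ≡⟨ cong -_ (sumFin-comm (λ s t → when ((merge t == b) ∧ (merge s == a)) (X t s))) ⟩
    - push X b a ∎
    where
    open ≡-Reasoning
    flip : ∀ s t → when ((merge s == a) ∧ (merge t == b)) (X s t) ≡ - when ((merge t == b) ∧ (merge s == a)) (X t s)
    flip s t = trans (cong₂ when (Bool.∧-comm (merge s == a) (merge t == b)) (X-anti s t))
                     (when-neg ((merge t == b) ∧ (merge s == a)) (X t s))

  push-supported : ∀ X → IsAntisymmetric X → IsSupportedOn G X → IsSupportedOn G/e (push X)
  push-supported X X-anti X-supp a b a≁b with toSum (a ≟ b)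
  ... | inj₁ refl = ≡-neg⇒≡0 (push X a a) (push-antisym X X-anti a a)
  ... | inj₂ a≢b  = sumFin-zero (λ s → sumFin-zero (λ t → vanish s t))
    where
    vanish : ∀ s t → when ((merge s == a) ∧ (merge t == b)) (X s t) ≡ 0ℚ
    vanish s t with (merge s == a) ∧ (merge t == b) in here
    ... | false = refl
    ... | true with pairEq⇒≡ (merge s) (merge t) a b here | adj G s t in s~t | isUV u v s t in uv
    ...   | _           | false | _     = X-supp s t s~t
    ...   | ms≡a , mt≡b | true  | true  = contradiction (trans (sym ms≡a) (trans (isUV⇒merge≡ s t uv) mt≡b)) a≢b
    ...   | refl , refl | true  | false = contradiction (contract-edge s t (edge∖e⁺ s~t uv)) (λ ab → true≢false (trans (sym ab) a≁b))

  push-divergence-free : ∀ X → (∀ s → sumFin (X s) ≡ 0ℚ) → ∀ a → sumFin (push X a) ≡ 0ℚ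
  push-divergence-free X X-div a = begin
    sumFin (λ b → sumFin₂ (λ s t → when ((merge s == a) ∧ (merge t == b)) (X s t)))
      ≡⟨ sumFin-comm (λ b s → sumFin (λ t → when ((merge s == a) ∧ (merge t == b)) (X s t))) ⟩
    sumFin (λ s → sumFin (λ b → sumFin (λ t → when ((merge s == a) ∧ (merge t == b)) (X s t))))
      ≡⟨ sumFin-cong (λ s → sumFin-comm (λ b t → when ((merge s == a) ∧ (merge t == b)) (X s t))) ⟩
    sumFin₂ (λ s t → sumFin (λ b → when ((merge s == a) ∧ (merge t == b)) (X s t)))
      ≡⟨ sumFin-cong (λ s → sumFin-cong (λ t → collapse-b s t)) ⟩
    sumFin₂ (λ s t → when (merge s == a) (X s t))
      ≡⟨ sumFin-cong (λ s → when-distrib-sumFin (merge s == a) (X s)) ⟨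
    sumFin (λ s → when (merge s == a) (sumFin (X s)))
      ≡⟨ sumFin-zero (λ s → trans (cong (when (merge s == a)) (X-div s)) (when-zero (merge s == a))) ⟩
    0ℚ ∎
    where
    open ≡-Reasoning
    collapse-b : ∀ s t → sumFin (λ b → when ((merge s == a) ∧ (merge t == b)) (X s t)) ≡ when (merge s == a) (X s t)
    collapse-b s t = begin
      sumFin (λ b → when ((merge s == a) ∧ (merge t == b)) (X s t))
        ≡⟨ sumFin-cong (λ b → trans (when-∧ (merge s == a) (merge t == b) (X s t))
                                    (trans (when-comm (merge s == a) (merge t == b) (X s t))
                                           (cong (λ c → when c (when (merge s == a) (X s t))) (==-sym (merge t) b)))) ⟩
      sumFin (λ b → when (b == merge t) (when (merge s == a) (X s t)))
        ≡⟨ sumFin-delta (merge t) (λ _ → when (merge s == a) (X s t)) ⟩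
      when (merge s == a) (X s t) ∎

  -- A walk s₁ t₁ t₂ t₃ in G ∖ e whose ends merge is closed: otherwise it would join the two sides of e.
  merged-walk-closes : ∀ s₁ t₁ t₂ t₃ → adj G∖e s₁ t₁ ≡ true → adj G∖e t₁ t₂ ≡ true → adj G∖e t₂ t₃ ≡ true →
                       merge t₃ ≡ merge s₁ → merge t₁ ≢ merge u → merge t₂ ≢ merge u → t₃ ≡ s₁
  merged-walk-closes s₁ t₁ t₂ t₃ s₁t₁ t₁t₂ t₂t₃ t₃≈s₁ t₁-off t₂-off with merge-injective t₃ s₁ t₃≈s₁
  ... | inj₁ t₃≡s₁ = t₃≡s₁
  ... | inj₂ (inj₁ (refl , refl)) = ⊥-elim (true≢false (trans (sym t₁-side) (neighbour-of-v t₁ (proj₁ (edge∖e⁻ s₁t₁)) t₁≢u)))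
    where
    t₁≢u = proj₁ (merge≢merge-u⇒ t₁ t₁-off)
    t₂-side = neighbour-of-u t₂ (adj-flip G (proj₁ (edge∖e⁻ t₂t₃))) (proj₂ (merge≢merge-u⇒ t₂ t₂-off))
    t₁-side = side-closed t₂ t₁ t₂-side (adj-flip G∖e t₁t₂)
  ... | inj₂ (inj₂ (refl , refl)) = ⊥-elim (true≢false (trans (sym t₂-side) (neighbour-of-v t₂ (adj-flip G (proj₁ (edge∖e⁻ t₂t₃))) t₂≢u)))
    where
    t₂≢u = proj₁ (merge≢merge-u⇒ t₂ t₂-off)
    t₁-side = neighbour-of-u t₁ (proj₁ (edge∖e⁻ s₁t₁)) (proj₂ (merge≢merge-u⇒ t₁ t₁-off))
    t₂-side = side-closed t₁ t₂ t₁-side t₁t₂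

  push-circulation-lifted : ∀ X → IsHarmonic G X → ∀ a b d →
                            adj G/e a b ≡ true → adj G/e b d ≡ true → adj G/e d a ≡ true →
                            b ≢ merge u → d ≢ merge u → circulation (push X) a b d ≡ 0ℚ
  push-circulation-lifted X X-harmonic a b d ab bd da b-off d-off
    with contract-edge⁻ a b ab | contract-edge⁻ b d bd | contract-edge⁻ d a da
  ... | s₁ , t₁ , e₁ , ms₁ , mt₁ | s₂ , t₂ , e₂ , ms₂ , mt₂ | s₃ , t₃ , e₃ , ms₃ , mt₃ =
    lifted (merge-injective-off-u t₁ s₂ (trans mt₁ (sym ms₂)) (λ b≈u → b-off (trans (sym mt₁) b≈u)))
           (merge-injective-off-u t₂ s₃ (trans mt₂ (sym ms₃)) (λ d≈u → d-off (trans (sym mt₂) d≈u)))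
    where
    open IsHarmonic X-harmonic
    lifted : t₁ ≡ s₂ → t₂ ≡ s₃ → circulation (push X) a b d ≡ 0ℚ
    lifted refl refl = begin
      push X a b + push X b d + push X d a
        ≡⟨ cong₂ _+_ (cong₂ _+_ (push-edge′ X supported s₁ t₁ e₁ ms₁ mt₁) (push-edge′ X supported t₁ t₂ e₂ ms₂ mt₂))
                     (push-edge′ X supported t₂ t₃ e₃ ms₃ mt₃) ⟩
      X s₁ t₁ + X t₁ t₂ + X t₂ t₃
        ≡⟨ cong (λ z → X s₁ t₁ + X t₁ t₂ + X t₂ z) t₃≡s₁ ⟩
      circulation X s₁ t₁ t₂
        ≡⟨ circulation-free s₁ t₁ t₂ (proj₁ (edge∖e⁻ e₁)) (proj₁ (edge∖e⁻ e₂))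
                            (adj-flip G (subst (λ z → adj G t₂ z ≡ true) t₃≡s₁ (proj₁ (edge∖e⁻ e₃)))) ⟩
      0ℚ ∎
      where
      open ≡-Reasoning
      t₃≡s₁ : t₃ ≡ s₁
      t₃≡s₁ = merged-walk-closes s₁ t₁ t₂ t₃ e₁ e₂ e₃ (trans mt₃ (sym ms₁))
                (λ t₁≈u → b-off (trans (sym mt₁) t₁≈u)) (λ t₂≈u → d-off (trans (sym mt₂) t₂≈u))

  push-circulation-free : ∀ X → IsHarmonic G X → ∀ a b d → adj G/e a b ≡ true → adj G/e b d ≡ true → adj G/e a d ≡ true →
                          circulation (push X) a b d ≡ 0ℚ
  push-circulation-free X X-harmonic a b d ab bd ad with toSum (b ≟ merge u) | toSum (d ≟ merge u)
  ... | inj₁ refl | _ =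
    circulation-rotate (push X) d a b (circulation-rotate (push X) b d a
      (push-circulation-lifted X X-harmonic b d a bd (adj-flip G/e {a} {d} ad) ab (adj⇒≢ G/e {b} {d} bd ∘ sym) (adj⇒≢ G/e {a} {b} ab)))
  ... | inj₂ b-off | inj₁ refl =
    circulation-rotate (push X) d a b
      (push-circulation-lifted X X-harmonic d a b (adj-flip G/e {a} {d} ad) ab bd (adj⇒≢ G/e {a} {d} ad) b-off)
  ... | inj₂ b-off | inj₂ d-off = push-circulation-lifted X X-harmonic a b d ab bd (adj-flip G/e {a} {d} ad) b-off d-off

  pull-antisym : ∀ Y → IsAntisymmetric Y → IsAntisymmetric (pull Y)
  pull-antisym Y Y-anti s t =
    trans (cong₂ when (adj-sym G∖e s t) (Y-anti (merge s) (merge t))) (when-neg (adj G∖e t s) (Y (merge t) (merge s)))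

  pull-supported : ∀ Y → IsSupportedOn G (pull Y)
  pull-supported Y s t s≁t = when-false (Y (merge s) (merge t)) (∧-falseˡ (not (isUV u v s t)) s≁t)

  triangle-edge∖e : ∀ i j k → adj G i j ≡ true → adj G i k ≡ true → adj G j k ≡ true → adj G∖e i j ≡ true
  triangle-edge∖e i j k i~j i~k j~k = edge∖e⁺ i~j (isUV-false i j (λ { refl refl → no-common-neighbour k i~k j~k })
                                                             (λ { refl refl → no-common-neighbour k j~k i~k }))

  pull-circulation-free : ∀ Y → IsHarmonic G/e Y → ∀ i j k → adj G i j ≡ true → adj G j k ≡ true → adj G i k ≡ true →
                          circulation (pull Y) i j k ≡ 0ℚ
  pull-circulation-free Y Y-harmonic i j k i~j j~k i~k = begin
    pull Y i j + pull Y j k + pull Y k i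
      ≡⟨ cong₂ _+_ (cong₂ _+_ (when-true _ ij) (when-true _ jk)) (when-true _ ki) ⟩
    circulation Y (merge i) (merge j) (merge k)
      ≡⟨ IsHarmonic.circulation-free Y-harmonic (merge i) (merge j) (merge k)
           (contract-edge i j ij) (contract-edge j k jk) (contract-edge i k ik) ⟩
    0ℚ ∎
    where
    open ≡-Reasoning
    ij = triangle-edge∖e i j k i~j i~k j~k
    jk = triangle-edge∖e j k i j~k (adj-flip G i~j) (adj-flip G i~k)
    ik = triangle-edge∖e i k j i~k i~j (adj-flip G j~k)
    ki = trans (adj-sym G∖e k i) ik

  fibreCount : Fin (suc n) → Fin n → ℚ
  fibreCount s b = sumFin (λ t → indicator ((merge t == b) ∧ adj G∖e s t))

  sumFin-pull : ∀ Y s → sumFin (pull Y s) ≡ sumFin (λ b → fibreCount s b * Y (merge s) b)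
  sumFin-pull Y s = begin
    sumFin (λ t → when (adj G∖e s t) (Y (merge s) (merge t)))
      ≡⟨ sumFin-cong (λ t → sumFin-delta (merge t) (λ b → when (adj G∖e s t) (Y (merge s) b))) ⟨
    sumFin₂ (λ t b → when (b == merge t) (when (adj G∖e s t) (Y (merge s) b)))
      ≡⟨ sumFin-comm (λ t b → when (b == merge t) (when (adj G∖e s t) (Y (merge s) b))) ⟩
    sumFin₂ (λ b t → when (b == merge t) (when (adj G∖e s t) (Y (merge s) b)))
      ≡⟨ sumFin-cong (λ b → sumFin-cong (λ t → trans (cong (λ c → when c (when (adj G∖e s t) (Y (merge s) b))) (==-sym b (merge t)))
                                                       (when-∧-indicator (merge t == b) (adj G∖e s t) (Y (merge s) b)))) ⟩
    sumFin (λ b → sumFin (λ t → indicator ((merge t == b) ∧ adj G∖e s t) * Y (merge s) b))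
      ≡⟨ sumFin-cong (λ b → *-distribʳ-sumFin (Y (merge s) b) (λ t → indicator ((merge t == b) ∧ adj G∖e s t))) ⟨
    sumFin (λ b → fibreCount s b * Y (merge s) b) ∎
    where open ≡-Reasoning

  fibreCount-edge : ∀ s y → adj G∖e s y ≡ true → fibreCount s (merge y) ≡ 1ℚ
  fibreCount-edge s y sy =
    trans (sumFin-single y (λ t → indicator ((merge t == merge y) ∧ adj G∖e s t)) others)
          (cong indicator (∧-true⁺ (==-refl (merge y)) sy))
    where
    others : ∀ t → t ≢ y → indicator ((merge t == merge y) ∧ adj G∖e s t) ≡ 0ℚ
    others t t≢y with (merge t == merge y) ∧ adj G∖e s t in here
    ... | false = refl
    ... | true  = let (mt≡my , st) = ∧-true⁻ {merge t == merge y} here in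
                  contradiction (proj₂ (merge-edge-injective s t s y st sy refl (==⇒≡ mt≡my))) t≢y

  fibreCount-endpoint : ∀ w b → b ≢ merge u → fibreCount w b ≡ indicator (adj G∖e w (split b))
  fibreCount-endpoint w b b-off =
    trans (sumFin-single (split b) (λ t → indicator ((merge t == b) ∧ adj G∖e w t)) others)
          (cong (λ c → indicator (c ∧ adj G∖e w (split b))) (trans (cong (_== b) (merge-split b)) (==-refl b)))
    where
    others : ∀ t → t ≢ split b → indicator ((merge t == b) ∧ adj G∖e w t) ≡ 0ℚ
    others t t≢split with merge t == b in mt≈b
    ... | false = refl
    ... | true  = contradiction (trans (cong split (sym (==⇒≡ mt≈b))) (split-merge t t≢v)) (t≢split ∘ sym)
      where
      t≢v : t ≢ v
      t≢v refl = b-off (trans (sym (==⇒≡ mt≈b)) merge-v≡merge-u)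

  side/e : Fin n → Bool
  side/e b = side (split b)

  side/e-merge-u : side/e (merge u) ≡ true
  side/e-merge-u = trans (cong side (split-merge u u≢v)) side-u

  endpoint-adjacency : ∀ b → adj G/e (merge u) b ≡ true →
                       adj G∖e u (split b) ≡ side/e b × adj G∖e v (split b) ≡ not (side/e b)
  endpoint-adjacency b ub with contract-edge⁻ (merge u) b ub
  ... | x , y , xy , mx≡mu , refl =
    subst (λ z → adj G∖e u z ≡ side z × adj G∖e v z ≡ not (side z)) (sym (split-merge y y≢v))
          (from-endpoint (merge-fibre-u x mx≡mu))
    where
    y≢v : y ≢ v
    y≢v refl = adj⇒≢ G/e {merge u} {merge v} ub (sym merge-v≡merge-u)
    not-both : adj G∖e u y ≡ true → adj G∖e v y ≡ true → ⊥
    not-both uy vy = no-common-neighbour y (proj₁ (edge∖e⁻ uy)) (proj₁ (edge∖e⁻ vy))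
    from-endpoint : x ≡ u ⊎ x ≡ v → adj G∖e u y ≡ side y × adj G∖e v y ≡ not (side y)
    from-endpoint (inj₁ refl) =
      let y-side = trans (endpoint-neighbour-side x y (inj₁ refl) xy) side-u in
      trans xy (sym y-side) , trans (Bool.¬-not (not-both xy)) (cong not (sym y-side))
    from-endpoint (inj₂ refl) =
      let y-side = trans (endpoint-neighbour-side x y (inj₂ refl) xy) side-v in
      trans (Bool.¬-not (λ uy → not-both uy xy)) (sym y-side) , trans xy (cong not (sym y-side))

  side/e-closed : ∀ a b → a ≢ merge u → side/e a ≡ true → adj G/e a b ≡ true → side/e b ≡ true
  side/e-closed a b a-off a-side ab with contract-edge⁻ a b ab
  ... | x , y , xy , refl , refl = trans (cong side (split-merge y y≢v)) y-side
    where
    x≢v = proj₂ (merge≢merge-u⇒ x a-off)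
    y-side : side y ≡ true
    y-side = side-closed x y (trans (cong side (sym (split-merge x x≢v))) a-side) xy
    y≢v : y ≢ v
    y≢v refl = true≢false (trans (sym y-side) side-v)

  -- Every edge of G/e leaving side/e starts at the merged vertex.
  flux-side/e : ∀ Y → IsSupportedOn G/e Y → flux Y side/e ≡ sumFin (λ b → when (not (side/e b)) (Y (merge u) b))
  flux-side/e Y Y-supp = trans (sumFin-single (merge u) row others)
                           (sumFin-cong (λ b → when-true (when (not (side/e b)) (Y (merge u) b)) side/e-merge-u))
    where
    row : Fin n → ℚ
    row a = sumFin (λ b → when (side/e a) (when (not (side/e b)) (Y a b)))
    others : ∀ a → a ≢ merge u → row a ≡ 0ℚ
    others a a-off = sumFin-zero vanish
      where
      vanish : ∀ b → when (side/e a) (when (not (side/e b)) (Y a b)) ≡ 0ℚ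
      vanish b with side/e a in a-side | side/e b in b-side | adj G/e a b in ab
      ... | false | _     | _     = refl
      ... | true  | true  | _     = refl
      ... | true  | false | false = Y-supp a b ab
      ... | true  | false | true  = contradiction (trans (sym (side/e-closed a b a-off a-side ab)) b-side) true≢false

  sumFin-pull-endpoint : ∀ Y → IsSupportedOn G/e Y → ∀ w → merge w ≡ merge u →
                         sumFin (pull Y w) ≡ sumFin (λ b → when (adj G∖e w (split b)) (Y (merge u) b))
  sumFin-pull-endpoint Y Y-supp w mw≡mu =
    trans (sumFin-pull Y w) (sumFin-cong (λ b → trans (cong (λ a → fibreCount w b * Y a b) mw≡mu) (pointwise b)))
    where
    pointwise : ∀ b → fibreCount w b * Y (merge u) b ≡ when (adj G∖e w (split b)) (Y (merge u) b)
    pointwise b with toSum (b ≟ merge u)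
    ... | inj₁ refl = trans (cong (fibreCount w b *_) Y-loop) (trans (ℚ.*-zeroʳ (fibreCount w b))
                            (sym (trans (cong (when (adj G∖e w (split b))) Y-loop) (when-zero (adj G∖e w (split b))))))
      where
      Y-loop : Y b b ≡ 0ℚ
      Y-loop = Y-supp b b (adj-irrefl G/e b)
    ... | inj₂ b-off = trans (cong (_* Y (merge u) b) (fibreCount-endpoint w b b-off))
                             (indicator-* (adj G∖e w (split b)) (Y (merge u) b))

  endpoint-u-sides : ∀ Y → IsSupportedOn G/e Y → ∀ b →
                     when (adj G∖e u (split b)) (Y (merge u) b) ≡ when (side/e b) (Y (merge u) b)
  endpoint-u-sides Y Y-supp b with adj G/e (merge u) b in ub
  ... | true  = cong (λ c → when c (Y (merge u) b)) (proj₁ (endpoint-adjacency b ub))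
  ... | false = when-irrelevant (adj G∖e u (split b)) (side/e b) (Y-supp (merge u) b ub)

  endpoint-v-sides : ∀ Y → IsSupportedOn G/e Y → ∀ b →
                     when (adj G∖e v (split b)) (Y (merge u) b) ≡ when (not (side/e b)) (Y (merge u) b)
  endpoint-v-sides Y Y-supp b with adj G/e (merge u) b in ub
  ... | true  = cong (λ c → when c (Y (merge u) b)) (proj₂ (endpoint-adjacency b ub))
  ... | false = when-irrelevant (adj G∖e v (split b)) (not (side/e b)) (Y-supp (merge u) b ub)

  pull-divergence-v : ∀ Y → IsHarmonic G/e Y → sumFin (pull Y v) ≡ 0ℚ
  pull-divergence-v Y Y-harmonic = begin
    sumFin (pull Y v)                                            ≡⟨ sumFin-pull-endpoint Y supported v merge-v≡merge-u ⟩
    sumFin (λ b → when (adj G∖e v (split b)) (Y (merge u) b))    ≡⟨ sumFin-cong (endpoint-v-sides Y supported) ⟩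
    sumFin (λ b → when (not (side/e b)) (Y (merge u) b))            ≡⟨ flux-side/e Y supported ⟨
    flux Y side/e                                                    ≡⟨ flux-zero Y antisym divergence-free side/e ⟩
    0ℚ                                                           ∎
    where
    open ≡-Reasoning
    open IsHarmonic Y-harmonic

  pull-divergence-u : ∀ Y → IsHarmonic G/e Y → sumFin (pull Y u) ≡ 0ℚ
  pull-divergence-u Y Y-harmonic = begin
    sumFin (pull Y u)                                            ≡⟨ sumFin-pull-endpoint Y supported u refl ⟩
    sumFin (λ b → when (adj G∖e u (split b)) (Y (merge u) b))    ≡⟨ sumFin-cong (endpoint-u-sides Y supported) ⟩
    sumFin (λ b → when (side/e b) (Y (merge u) b))                  ≡⟨ sumFin-cong (λ b → when-complement (side/e b) (Y (merge u) b)) ⟩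
    sumFin (λ b → Y (merge u) b + - when (not (side/e b)) (Y (merge u) b))
                                                                 ≡⟨ sumFin-sub (Y (merge u)) (λ b → when (not (side/e b)) (Y (merge u) b)) ⟩
    sumFin (Y (merge u)) + - sumFin (λ b → when (not (side/e b)) (Y (merge u) b))
                                                                 ≡⟨ cong₂ (λ p q → p + - q) (divergence-free (merge u)) v-side≡0 ⟩
    0ℚ                                                           ∎
    where
    open ≡-Reasoning
    open IsHarmonic Y-harmonic
    v-side≡0 : sumFin (λ b → when (not (side/e b)) (Y (merge u) b)) ≡ 0ℚ
    v-side≡0 = trans (sym (sumFin-cong (endpoint-v-sides Y supported)))
                     (trans (sym (sumFin-pull-endpoint Y supported v merge-v≡merge-u)) (pull-divergence-v Y Y-harmonic))

  pull-divergence-off : ∀ Y → IsHarmonic G/e Y → ∀ s → merge s ≢ merge u → sumFin (pull Y s) ≡ 0ℚ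
  pull-divergence-off Y Y-harmonic s s-off = begin
    sumFin (pull Y s)                                   ≡⟨ sumFin-pull Y s ⟩
    sumFin (λ b → fibreCount s b * Y (merge s) b)       ≡⟨ sumFin-cong one-preimage ⟩
    sumFin (Y (merge s))                                ≡⟨ divergence-free (merge s) ⟩
    0ℚ                                                  ∎
    where
    open ≡-Reasoning
    open IsHarmonic Y-harmonic
    one-preimage : ∀ b → fibreCount s b * Y (merge s) b ≡ Y (merge s) b
    one-preimage b with adj G/e (merge s) b in sb
    ... | false = trans (cong (fibreCount s b *_) (supported (merge s) b sb))
                        (trans (ℚ.*-zeroʳ (fibreCount s b)) (sym (supported (merge s) b sb)))
    ... | true with contract-edge⁻ (merge s) b sb
    ...   | x , y , xy , mx≡ms , refl with merge-injective-off-u x s mx≡ms (λ x≈u → s-off (trans (sym mx≡ms) x≈u))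
    ...     | refl = trans (cong (_* Y (merge x) (merge y)) (fibreCount-edge x y xy)) (ℚ.*-identityˡ (Y (merge x) (merge y)))

  pull-divergence-free : ∀ Y → IsHarmonic G/e Y → ∀ s → sumFin (pull Y s) ≡ 0ℚ
  pull-divergence-free Y Y-harmonic s with toSum (s ≟ u) | toSum (s ≟ v)
  ... | inj₁ refl | _         = pull-divergence-u Y Y-harmonic
  ... | inj₂ _    | inj₁ refl = pull-divergence-v Y Y-harmonic
  ... | inj₂ s≢u  | inj₂ s≢v  = pull-divergence-off Y Y-harmonic s (merge≢merge-u⇐ s s≢u s≢v)

  push-harmonic : ∀ X → IsHarmonic G X → IsHarmonic G/e (push X)
  push-harmonic X X-harmonic = record
    { antisym          = push-antisym X antisym
    ; supported        = push-supported X antisym supported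
    ; divergence-free  = push-divergence-free X divergence-free
    ; circulation-free = push-circulation-free X X-harmonic
    }
    where open IsHarmonic X-harmonic

  pull-harmonic : ∀ Y → IsHarmonic G/e Y → IsHarmonic G (pull Y)
  pull-harmonic Y Y-harmonic = record
    { antisym          = pull-antisym Y (IsHarmonic.antisym Y-harmonic)
    ; supported        = pull-supported Y
    ; divergence-free  = pull-divergence-free Y Y-harmonic
    ; circulation-free = pull-circulation-free Y Y-harmonic
    }

  pull∘push : ∀ X → IsHarmonic G X → ∀ s t → pull (push X) s t ≡ X s t
  pull∘push X X-harmonic s t with adj G s t in s~t | isUV u v s t in uv
  ... | false | _     = sym (IsHarmonic.supported X-harmonic s t s~t)
  ... | true  | false = push-edge X (IsHarmonic.supported X-harmonic) s t (edge∖e⁺ s~t uv)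
  ... | true  | true  = sym (on-cut-edge (isUV⇒≡ u v s t uv))
    where
    open IsHarmonic X-harmonic
    on-cut-edge : (s ≡ u × t ≡ v) ⊎ (s ≡ v × t ≡ u) → X s t ≡ 0ℚ
    on-cut-edge (inj₁ (refl , refl)) = harmonic-cut-edge X X-harmonic
    on-cut-edge (inj₂ (refl , refl)) = trans (antisym v u) (cong -_ (harmonic-cut-edge X X-harmonic))

  push∘pull : ∀ Y → IsHarmonic G/e Y → ∀ a b → push (pull Y) a b ≡ Y a b
  push∘pull Y Y-harmonic a b with adj G/e a b in ab
  ... | false = trans (sumFin-zero (λ s → sumFin-zero (vanish s))) (sym (IsHarmonic.supported Y-harmonic a b ab))
    where
    vanish : ∀ s t → when ((merge s == a) ∧ (merge t == b)) (pull Y s t) ≡ 0ℚ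
    vanish s t with (merge s == a) ∧ (merge t == b) in here | adj G∖e s t in st
    ... | false | _     = refl
    ... | true  | false = refl
    ... | true  | true with pairEq⇒≡ (merge s) (merge t) a b here
    ...   | refl , refl = contradiction (trans (sym (contract-edge s t st)) ab) true≢false
  ... | true with contract-edge⁻ a b ab
  ...   | x , y , xy , refl , refl =
    trans (sumFin-single₂ x y (λ s t → when ((merge s == merge x) ∧ (merge t == merge y)) (pull Y s t)) others)
          (trans (when-true _ (∧-true⁺ (==-refl (merge x)) (==-refl (merge y)))) (when-true _ xy))
    where
    others : ∀ s t → (s ≡ x → t ≡ y → ⊥) → when ((merge s == merge x) ∧ (merge t == merge y)) (pull Y s t) ≡ 0ℚ
    others s t ≢xy with (merge s == merge x) ∧ (merge t == merge y) in here | adj G∖e s t in st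
    ... | false | _     = refl
    ... | true  | false = refl
    ... | true  | true  = let (ms≡mx , mt≡my) = pairEq⇒≡ (merge s) (merge t) (merge x) (merge y) here
                              (s≡x , t≡y)    = merge-edge-injective s t x y st xy ms≡mx mt≡my
                          in ⊥-elim (≢xy s≡x t≡y)

  push-linear : IsFlowLinear push
  push-linear c Xs Z Z≡Σ a b = begin
    sumFin₂ (λ s t → when (here s t) (Z s t))
      ≡⟨ sumFin-cong (λ s → sumFin-cong (λ t → trans (cong (when (here s t)) (Z≡Σ s t))
                                                     (when-combination (here s t) c (λ i → Xs i s t)))) ⟩
    sumFin (λ s → sumFin (λ t → combination c (λ i t → when (here s t) (Xs i s t)) t))
      ≡⟨ sumFin-cong (λ s → sumFin-combination c (λ i t → when (here s t) (Xs i s t))) ⟩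
    sumFin (λ s → combination c (λ i s → sumFin (λ t → when (here s t) (Xs i s t))) s)
      ≡⟨ sumFin-combination c (λ i s → sumFin (λ t → when (here s t) (Xs i s t))) ⟩
    flowCombination c (push ∘ Xs) a b ∎
    where
    open ≡-Reasoning
    here : Fin (suc n) → Fin (suc n) → Bool
    here s t = (merge s == a) ∧ (merge t == b)

  pull-linear : IsFlowLinear pull
  pull-linear c Ys Z Z≡Σ s t =
    trans (cong (when (adj G∖e s t)) (Z≡Σ (merge s) (merge t)))
          (when-combination (adj G∖e s t) c (λ i → Ys i (merge s) (merge t)))

  harmonicIso : HarmonicIso G G/e
  harmonicIso = record
    { to            = push
    ; from          = pull
    ; to-linear     = push-linear
    ; from-linear   = pull-linear
    ; to-harmonic   = push-harmonic
    ; from-harmonic = pull-harmonic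
    ; from∘to       = pull∘push
    ; to∘from       = push∘pull
    }

corollary3p5 : ∀ {n} (G : Graph (suc n)) (u v : Fin (suc n)) (v≢u : v ≢ u) →
               IsCutEdge G u v →
               ∀ (k : ℕ) → HasNullity (𝓗 G) k ⇔ HasNullity (𝓗 (contract G u v v≢u)) k
corollary3p5 G u v v≢u cut = HasNullity-⇔ (HarmonicIso⇒KernelIso (Contraction.harmonicIso G u v v≢u cut))
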